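{- For every $\epsilon>0$ and every $k$-SAT formula $F$, there exist $\delta>0$ and $n_0$ such that for all $n>n_0$: if a $k$-SAT formula on $n$ variables contains at least $\epsilon n^{v(F)}$ copies of $F$, then it contains at least $\delta n^{2v(F)}$ copies of $F[2]$.
   Context: A clause is a conjunction of $k$ literals ($x$ or $\overline x$) on $k$ distinct variables; a $k$-SAT formula is a set of clauses; $v(F)$ is the number of variables appearing in some clause of $F$. A subformula of $G$ is a subset of its clauses; two formulae are isomorphic if one is obtained from the other by relabeling variables; a copy of $F$ in $G$ is a subformula of $G$ isomorphic to $F$. The $2$-blowup $F[2]$ is obtained by replacing each variable $x$ by two duplicates $x,x'$ and replacing each clause by all clauses obtained by choosing, for each of its variables, one of the two duplicates (keeping the sign of each literal).
   Formalization: The parameter ε ranges over the positive rationals, and the witness δ is taken in the positive rationals. -}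

module Defs where

open import Data.Bool using (Bool; true; false; T; if_then_else_)
open import Data.Maybe using (Maybe; just; nothing; is-just; maybe)
open import Data.Nat using (ℕ; zero; suc; _+_; _*_; _^_)
open import Data.Fin using (Fin)
open import Data.Vec as V using (Vec; []; _∷_; lookup; replicate; zipWith; _++_; _[_]≔_)
open import Data.List as L using (List; []; _∷_; length; map; concatMap; filterᵇ)
open import Data.Bool.ListAction using (any)
open import Data.List.Membership.Propositional using (_∈_)
open import Data.List.Relation.Unary.All using (All)
open import Data.List.Relation.Unary.Unique.Propositional using (Unique)
open import Data.Product using (Σ; _×_)
open import Data.Integer using (+_)
open import Data.Rational using (ℚ; _/_; _≤_)
open import Relation.Binary.PropositionalEquality using (_≡_)
open import Function using (_⇔_)

-- A clause over the variables Fin n: for each variable x, either x does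
-- not occur (nothing), occurs positively (just true) or negatively
-- (just false).  This is exactly a set of literals on distinct variables.
Clause : ℕ → Set
Clause n = Vec (Maybe Bool) n

size : ∀ {n} → Clause n → ℕ
size []             = 0
size (nothing ∷ c)  = size c
size (just _ ∷ c)   = suc (size c)

IsKClause : ℕ → ∀ {n} → Clause n → Set
IsKClause k c = size c ≡ k

-- A formula over variables Fin n is a finite set of clauses, represented
-- by a duplicate-free list.
Formula : ℕ → Set
Formula n = List (Clause n)

record KSAT (k n : ℕ) : Set where
  constructor ksat
  field
    clauses  : Formula n
    distinct : Unique clauses
    kclauses : All (IsKClause k) clauses
open KSAT public

appears : ∀ {n} → Formula n → Fin n → Bool
appears F x = any (λ c → is-just (lookup c x)) F

v : ∀ {n} → Formula n → ℕ
v {n} F = length (filterᵇ (appears F) (L.allFin n))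

rename : ∀ {m n} → (Fin m → Fin n) → Clause m → Clause n
rename {m} {n} φ c =
  L.foldr (λ x acc → maybe (λ b → acc [ φ x ]≔ just b) acc (lookup c x))
          (replicate n nothing) (L.allFin m)

InjectiveOnVars : ∀ {m n} → Formula m → (Fin m → Fin n) → Set
InjectiveOnVars F φ =
  ∀ x y → T (appears F x) → T (appears F y) → φ x ≡ φ y → x ≡ y

_≈F_ : ∀ {n} → Formula n → Formula n → Set
F ≈F G = ∀ c → (c ∈ F) ⇔ (c ∈ G)

_≅_ : ∀ {m n} → Formula m → Formula n → Set
_≅_ {m} {n} F S = Σ (Fin m → Fin n) λ φ → InjectiveOnVars F φ × (map (rename φ) F ≈F S)

select : ∀ {A : Set} (xs : List A) → Vec Bool (length xs) → List A
select []       []            = []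
select (x ∷ xs) (true  ∷ s)   = x ∷ select xs s
select (x ∷ xs) (false ∷ s)   = select xs s

-- Since the clause list of G is duplicate-free, subformulae of G correspond
-- bijectively to subsets of positions.
Subformula : ∀ {n} → Formula n → Set
Subformula G = Vec Bool (length G)

IsCopy : ∀ {m n} → Formula m → (G : Formula n) → Subformula G → Set
IsCopy F G S = F ≅ select G S

ℕtoℚ : ℕ → ℚ
ℕtoℚ t = + t / 1

AtLeastCopies : ∀ {m n} → ℚ → Formula m → Formula n → Set
AtLeastCopies q F G =
  Σ (List (Subformula G)) λ Ss →
    Unique Ss × All (IsCopy F G) Ss × (q ≤ ℕtoℚ (length Ss))

allBools : ∀ m → List (Vec Bool m)
allBools zero    = [] ∷ []
allBools (suc m) = concatMap (λ s → (false ∷ s) ∷ (true ∷ s) ∷ []) (allBools m)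

-- Variables of F[2]: x ∈ Fin m is represented by x ↑ˡ m (first block),
-- its duplicate x' by m ↑ʳ x (second block).  The choice vector s says,
-- for each variable, whether the duplicate (true) or original (false) is used.
dupClause : ∀ {m} → Vec Bool m → Clause m → Clause (m + m)
dupClause s c =
  zipWith (λ b l → if b then nothing else l) s c ++
  zipWith (λ b l → if b then l else nothing) s c

-- F[2]: each clause replaced by all clauses obtained by choosing, for each of
-- its variables, one of the two duplicates (signs kept).  (The list may
-- contain repetitions; F[2] is the corresponding set of clauses.)
blowup2 : ∀ {m} → Formula m → Formula (m + m)
blowup2 {m} F = concatMap (λ c → map (λ s → dupClause s c) (allBools m)) F

module Submission where

-- Points ψ of the grid [n]^m are maps of the variables of F into those of G; let H be the set of
-- points embedding F into G. Each copy of F extends to n^(m-v) points of H, so ε n^v copies give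
-- |H| ≥ ε n^m. Iterating Cauchy–Schwarz over the m coordinates, H contains at least
-- |H|^(2^m) / n^(m 2^m - 2m) ≥ ε^(2^m) n^(2m) boxes {x, x′}^m. Only O(n^(2m-1)) boxes have
-- x i = x′ j for some i, j; each other box maps F[2] injectively onto a copy of F[2], and a copy
-- of F[2] arises from at most ((2m)^v n^(m-v))² boxes, since its at most 2m vertices must contain
-- the images of the variables of F under both x and x′.

open import Data.Bool using (Bool; true; false; T; _∧_; not; if_then_else_) renaming (_≟_ to _≟ᵇ_)
open import Data.Bool.ListAction using (all)
open import Data.Bool.Properties using (∧-assoc; T?)
open import Data.Empty using (⊥-elim)
open import Data.Fin as Fin using (Fin; zero; suc; _↑ˡ_; _↑ʳ_)
import Data.Fin.Properties as FinP
import Data.Integer as ℤ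
import Data.Integer.Properties as ℤP
open import Data.List as L using (List; []; _∷_; length; map; concatMap; _++_; cartesianProductWith; cartesianProduct)
open import Data.List.Membership.Propositional using (_∈_; find; lose)
open import Data.List.Membership.Propositional.Properties
  using (∈-map⁺; ∈-map⁻; ∈-allFin; ∈-concatMap⁺; ∈-concatMap⁻; ∈-filter⁺; ∈-filter⁻; ∈-deduplicate⁺; ∈-deduplicate⁻)
import Data.List.Properties as ListP
open import Data.List.Relation.Unary.All as All using (All; []; _∷_)
open import Data.List.Relation.Unary.AllPairs using ([]; _∷_)
open import Data.List.Relation.Unary.Any as Any using (here; there)
import Data.List.Relation.Unary.Any.Properties as AnyP
open import Data.List.Relation.Unary.Unique.Propositional using (Unique)
import Data.List.Relation.Unary.Unique.DecPropositional.Properties as UniqueP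
open import Data.Maybe using (Maybe; just; nothing; maybe; is-just)
import Data.Maybe.Properties as MP
open import Data.Nat using (ℕ; zero; suc; _+_; _*_; _^_; _≤_; _>_; z≤n; s≤s; NonZero)
open import Data.Nat.Coprimality as Coprime using (1-coprimeTo)
open import Data.Nat.Properties
open import Data.Nat.Tactic.RingSolver using (solve-∀)
open import Data.Product using (Σ; _×_; _,_; proj₁; proj₂; uncurry)
open import Data.Rational as ℚ using (ℚ; mkℚ; 0ℚ; _<_) renaming (_*_ to _*ℚ_)
import Data.Rational.Properties as ℚP
import Data.Rational.Unnormalised as ℚᵘ
import Data.Rational.Unnormalised.Properties as ℚᵘP
open import Data.Sum using (_⊎_; inj₁; inj₂)
open import Data.Vec as V using (Vec; []; _∷_; lookup)
import Data.Vec.Properties as VP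
open import Function using (_∘_; Equivalence; mk⇔)
open import Relation.Binary.PropositionalEquality
open import Relation.Nullary using (Dec; yes; no; ¬_; does)
open import Relation.Nullary.Decidable using (_×-dec_; _→-dec_; ¬?)

open import Defs

private
  variable
    A B C : Set

∑ : List A → (A → ℕ) → ℕ
∑ []       f = 0
∑ (x ∷ xs) f = f x + ∑ xs f

∑-cong : ∀ (xs : List A) {f g : A → ℕ} → (∀ x → f x ≡ g x) → ∑ xs f ≡ ∑ xs g
∑-cong []       f≡g = refl
∑-cong (x ∷ xs) f≡g = cong₂ _+_ (f≡g x) (∑-cong xs f≡g)

∑-mono-≤ : ∀ (xs : List A) {f g : A → ℕ} → (∀ x → f x ≤ g x) → ∑ xs f ≤ ∑ xs g
∑-mono-≤ []       f≤g = z≤n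
∑-mono-≤ (x ∷ xs) f≤g = +-mono-≤ (f≤g x) (∑-mono-≤ xs f≤g)

∑-distrib-+ : ∀ (xs : List A) (f g : A → ℕ) → ∑ xs (λ x → f x + g x) ≡ ∑ xs f + ∑ xs g
∑-distrib-+ []       f g = refl
∑-distrib-+ (x ∷ xs) f g rewrite ∑-distrib-+ xs f g = shuffle (f x) (g x) (∑ xs f) (∑ xs g)
  where
  shuffle : ∀ a b c d → a + b + (c + d) ≡ a + c + (b + d)
  shuffle = solve-∀

∑-*ˡ : ∀ (xs : List A) (c : ℕ) (f : A → ℕ) → c * ∑ xs f ≡ ∑ xs (λ x → c * f x)
∑-*ˡ []       c f = *-zeroʳ c
∑-*ˡ (x ∷ xs) c f = trans (*-distribˡ-+ c (f x) (∑ xs f)) (cong (c * f x +_) (∑-*ˡ xs c f))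

∑-*ʳ : ∀ (xs : List A) (f : A → ℕ) (c : ℕ) → ∑ xs f * c ≡ ∑ xs (λ x → f x * c)
∑-*ʳ xs f c = trans (*-comm (∑ xs f) c) (trans (∑-*ˡ xs c f) (∑-cong xs (λ x → *-comm c (f x))))

∑-const : ∀ (xs : List A) (c : ℕ) → ∑ xs (λ _ → c) ≡ length xs * c
∑-const []       c = refl
∑-const (x ∷ xs) c = cong (c +_) (∑-const xs c)

∑-zero : ∀ (xs : List A) → ∑ xs (λ _ → 0) ≡ 0
∑-zero xs = trans (∑-const xs 0) (*-zeroʳ (length xs))

length≡∑1 : ∀ (xs : List A) → length xs ≡ ∑ xs (λ _ → 1)
length≡∑1 xs = sym (trans (∑-const xs 1) (*-identityʳ (length xs)))

∑-++ : ∀ (xs ys : List A) (f : A → ℕ) → ∑ (xs ++ ys) f ≡ ∑ xs f + ∑ ys f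
∑-++ []       ys f = refl
∑-++ (x ∷ xs) ys f = trans (cong (f x +_) (∑-++ xs ys f)) (sym (+-assoc (f x) _ _))

∑-map : (xs : List A) (h : A → B) (f : B → ℕ) → ∑ (map h xs) f ≡ ∑ xs (λ x → f (h x))
∑-map []       h f = refl
∑-map (x ∷ xs) h f = cong (f (h x) +_) (∑-map xs h f)

∑-cartesianProductWith : ∀ (h : A → B → C) (xs : List A) (ys : List B) (g : C → ℕ) →
  ∑ (cartesianProductWith h xs ys) g ≡ ∑ xs (λ x → ∑ ys (λ y → g (h x y)))
∑-cartesianProductWith h []       ys g = refl
∑-cartesianProductWith h (x ∷ xs) ys g = begin
  ∑ (map (h x) ys ++ cartesianProductWith h xs ys) g     ≡⟨ ∑-++ (map (h x) ys) _ g ⟩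
  ∑ (map (h x) ys) g + ∑ (cartesianProductWith h xs ys) g ≡⟨ cong₂ _+_ (∑-map ys (h x) g) (∑-cartesianProductWith h xs ys g) ⟩
  ∑ ys (λ y → g (h x y)) + ∑ xs (λ x → ∑ ys (λ y → g (h x y))) ∎
  where open ≡-Reasoning

∑-comm : (xs : List A) (ys : List B) (f : A → B → ℕ) →
  ∑ xs (λ x → ∑ ys (f x)) ≡ ∑ ys (λ y → ∑ xs (λ x → f x y))
∑-comm []       ys f = sym (∑-zero ys)
∑-comm (x ∷ xs) ys f =
  trans (cong (∑ ys (f x) +_) (∑-comm xs ys f)) (sym (∑-distrib-+ ys (f x) _))

∑-square : ∀ (xs : List A) (f : A → ℕ) → ∑ xs f * ∑ xs f ≡ ∑ xs (λ x → ∑ xs (λ y → f x * f y))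
∑-square xs f = trans (∑-*ʳ xs f (∑ xs f)) (∑-cong xs (λ x → ∑-*ˡ xs (f x) f))

∑-positive : ∀ (xs : List A) (f : A → ℕ) {x} → x ∈ xs → 1 ≤ f x → 1 ≤ ∑ xs f
∑-positive (y ∷ xs) f (here refl) 1≤fx = ≤-trans 1≤fx (m≤m+n (f y) _)
∑-positive (y ∷ xs) f (there x∈)  1≤fx = ≤-trans (∑-positive xs f x∈ 1≤fx) (m≤n+m _ (f y))

∑-mono-≤-∈ : ∀ (xs : List A) {f g : A → ℕ} → (∀ {x} → x ∈ xs → f x ≤ g x) → ∑ xs f ≤ ∑ xs g
∑-mono-≤-∈ []       f≤g = z≤n
∑-mono-≤-∈ (x ∷ xs) f≤g = +-mono-≤ (f≤g (here refl)) (∑-mono-≤-∈ xs (f≤g ∘ there))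

∑-zero⁻ : ∀ (xs : List A) (f : A → ℕ) → ∑ xs f ≡ 0 → ∀ {x} → x ∈ xs → f x ≡ 0
∑-zero⁻ (y ∷ xs) f e (here refl) = m+n≡0⇒m≡0 (f y) e
∑-zero⁻ (y ∷ xs) f e (there x∈)  = ∑-zero⁻ xs f (m+n≡0⇒n≡0 (f y) e) x∈

∑ᴬ : ∀ {P : A → Set} {xs} → All P xs → (∀ {x} → P x → ℕ) → ℕ
∑ᴬ []         f = 0
∑ᴬ (px ∷ pxs) f = f px + ∑ᴬ pxs f

module _ {P : A → Set} where

  ∑ᴬ-const : ∀ {xs} (pxs : All P xs) c → ∑ᴬ pxs (λ _ → c) ≡ length xs * c
  ∑ᴬ-const []         c = refl
  ∑ᴬ-const (px ∷ pxs) c = cong (c +_) (∑ᴬ-const pxs c)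

  ∑ᴬ-cong : ∀ {xs} (pxs : All P xs) {f g : ∀ {x} → P x → ℕ} → (∀ {x} (px : P x) → f px ≡ g px) → ∑ᴬ pxs f ≡ ∑ᴬ pxs g
  ∑ᴬ-cong []         f≗g = refl
  ∑ᴬ-cong (px ∷ pxs) f≗g = cong₂ _+_ (f≗g px) (∑ᴬ-cong pxs f≗g)

  ∑-∑ᴬ-comm : ∀ (ys : List B) {xs} (pxs : All P xs) (f : ∀ {x} → P x → B → ℕ) →
    ∑ ys (λ y → ∑ᴬ pxs (λ px → f px y)) ≡ ∑ᴬ pxs (λ px → ∑ ys (f px))
  ∑-∑ᴬ-comm ys []         f = ∑-zero ys
  ∑-∑ᴬ-comm ys (px ∷ pxs) f = trans (∑-distrib-+ ys _ _) (cong (∑ ys (f px) +_) (∑-∑ᴬ-comm ys pxs f))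

square-* : ∀ a b → a * b * (a * b) ≡ a * a * (b * b)
square-* = solve-∀

^-2^-suc : ∀ x j → x ^ (2 ^ suc j) ≡ x ^ (2 ^ j) * x ^ (2 ^ j)
^-2^-suc x j = trans (cong (λ e → x ^ (2 ^ j + e)) (+-identityʳ (2 ^ j))) (^-distribˡ-+-* x (2 ^ j) (2 ^ j))

^-distrib-* : ∀ a b o → (a * b) ^ o ≡ a ^ o * b ^ o
^-distrib-* a b zero    = refl
^-distrib-* a b (suc o) = trans (cong (a * b *_) (^-distrib-* a b o)) (shuffle a b (a ^ o) (b ^ o))
  where
  shuffle : ∀ a b x y → a * b * (x * y) ≡ a * x * (b * y)
  shuffle = solve-∀

^-distribˡ-+₄ : ∀ n a b c d → n ^ (a + b + c + d) ≡ n ^ a * n ^ b * n ^ c * n ^ d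
^-distribˡ-+₄ n a b c d = begin
  n ^ (a + b + c + d)               ≡⟨ ^-distribˡ-+-* n (a + b + c) d ⟩
  n ^ (a + b + c) * n ^ d           ≡⟨ cong (_* n ^ d) (^-distribˡ-+-* n (a + b) c) ⟩
  n ^ (a + b) * n ^ c * n ^ d       ≡⟨ cong (λ z → z * n ^ c * n ^ d) (^-distribˡ-+-* n a b) ⟩
  n ^ a * n ^ b * n ^ c * n ^ d     ∎
  where open ≡-Reasoning

-- Cauchy–Schwarz and the power mean inequality

2ab≤a²+b²-ordered : ∀ {a b} → a ≤ b → a * b + a * b ≤ a * a + b * b
2ab≤a²+b²-ordered {a} a≤b with m≤n⇒∃[o]m+o≡n a≤b
... | d , refl = ≤-trans (m≤m+n _ (d * d)) (≤-reflexive (expand a d))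
  where
  expand : ∀ a d → a * (a + d) + a * (a + d) + d * d ≡ a * a + (a + d) * (a + d)
  expand = solve-∀

2ab≤a²+b² : ∀ a b → a * b + a * b ≤ a * a + b * b
2ab≤a²+b² a b with ≤-total a b
... | inj₁ a≤b = 2ab≤a²+b²-ordered a≤b
... | inj₂ b≤a = subst₂ _≤_ (cong₂ _+_ (*-comm b a) (*-comm b a)) (+-comm (b * b) (a * a))
                        (2ab≤a²+b²-ordered b≤a)

∑-double : ∀ (xs : List A) (f : A → ℕ) → 2 * ∑ xs f ≡ ∑ xs (λ x → f x + f x)
∑-double xs f = trans (cong (∑ xs f +_) (+-identityʳ (∑ xs f))) (sym (∑-distrib-+ xs f f))

cauchy-schwarz : ∀ (xs : List A) (f : A → ℕ) →
  ∑ xs f * ∑ xs f ≤ length xs * ∑ xs (λ x → f x * f x)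
cauchy-schwarz xs f = *-cancelˡ-≤ 2 (begin
  2 * (∑ xs f * ∑ xs f)                                ≡⟨ cong (2 *_) (∑-square xs f) ⟩
  2 * ∑ xs (λ x → ∑ xs (λ y → f x * f y))              ≡⟨ ∑-double xs _ ⟩
  ∑ xs (λ x → ∑ xs (λ y → f x * f y) + ∑ xs (λ y → f x * f y))
                                                       ≡⟨ ∑-cong xs (λ x → ∑-distrib-+ xs _ _) ⟨
  ∑ xs (λ x → ∑ xs (λ y → f x * f y + f x * f y))      ≤⟨ ∑-mono-≤ xs (λ x → ∑-mono-≤ xs (λ y → 2ab≤a²+b² (f x) (f y))) ⟩
  ∑ xs (λ x → ∑ xs (λ y → f x * f x + f y * f y))      ≡⟨ ∑-cong xs (λ x → ∑-distrib-+ xs _ _) ⟩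
  ∑ xs (λ x → ∑ xs (λ _ → f x * f x) + S)              ≡⟨ ∑-distrib-+ xs _ _ ⟩
  ∑ xs (λ x → ∑ xs (λ _ → f x * f x)) + ∑ xs (λ _ → S) ≡⟨ cong₂ _+_ (∑-cong xs (λ x → ∑-const xs _)) (∑-const xs S) ⟩
  ∑ xs (λ x → N * (f x * f x)) + N * S                 ≡⟨ cong (_+ N * S) (∑-*ˡ xs N _) ⟨
  N * S + N * S                                        ≡⟨ cong (N * S +_) (+-identityʳ (N * S)) ⟨
  2 * (N * S)                                          ∎)
  where
  open ≤-Reasoning
  N : ℕ
  N = length xs
  S : ℕ
  S = ∑ xs (λ x → f x * f x)

-- Multiplied through by N, which avoids the exponent 2^j - 1.
power-mean : ∀ (xs : List A) (f : A → ℕ) j →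
  ∑ xs f ^ (2 ^ j) * length xs ≤ length xs ^ (2 ^ j) * ∑ xs (λ x → f x ^ (2 ^ j))
power-mean xs f zero = ≤-reflexive (begin-equality
  ∑ xs f ^ 1 * length xs ≡⟨ *-comm _ (length xs) ⟩
  length xs * ∑ xs f ^ 1 ≡⟨ cong (length xs *_) (*-identityʳ (∑ xs f)) ⟩
  length xs * ∑ xs f     ≡⟨ cong₂ _*_ (*-identityʳ (length xs)) (∑-cong xs (λ x → *-identityʳ (f x))) ⟨
  length xs ^ 1 * ∑ xs (λ x → f x ^ 1) ∎)
  where open ≤-Reasoning
power-mean [] f (suc j) = ≤-reflexive (trans (*-zeroʳ (0 ^ (2 ^ suc j))) (sym (*-zeroʳ (0 ^ (2 ^ suc j)))))
power-mean xs@(_ ∷ _) f (suc j) = *-cancelʳ-≤ _ _ N (begin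
  M ^ (2 ^ suc j) * N * N                ≡⟨ cong (λ z → z * N * N) (^-2^-suc M j) ⟩
  M ^ P * M ^ P * N * N                  ≡⟨ rearrange (M ^ P) N ⟩
  (M ^ P * N) * (M ^ P * N)              ≤⟨ *-mono-≤ (power-mean xs f j) (power-mean xs f j) ⟩
  (N ^ P * S) * (N ^ P * S)              ≡⟨ square-* (N ^ P) S ⟩
  N ^ P * N ^ P * (S * S)                ≤⟨ *-monoʳ-≤ (N ^ P * N ^ P) (cauchy-schwarz xs (λ x → f x ^ P)) ⟩
  N ^ P * N ^ P * (N * ∑ xs (λ x → f x ^ P * f x ^ P))
    ≡⟨ cong₂ (λ u w → u * (N * w)) (^-2^-suc N j) (∑-cong xs (λ x → ^-2^-suc (f x) j)) ⟨
  N ^ (2 ^ suc j) * (N * ∑ xs (λ x → f x ^ (2 ^ suc j)))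
    ≡⟨ x*[y*z]≡x*z*y (N ^ (2 ^ suc j)) N _ ⟩
  N ^ (2 ^ suc j) * ∑ xs (λ x → f x ^ (2 ^ suc j)) * N ∎)
  where
  open ≤-Reasoning
  N : ℕ
  N = length xs
  M : ℕ
  M = ∑ xs f
  P : ℕ
  P = 2 ^ j
  S : ℕ
  S = ∑ xs (λ x → f x ^ P)
  rearrange : ∀ a n → a * a * n * n ≡ a * n * (a * n)
  rearrange = solve-∀
  x*[y*z]≡x*z*y : ∀ x y z → x * (y * z) ≡ x * z * y
  x*[y*z]≡x*z*y = solve-∀

χ : Bool → ℕ
χ true  = 1
χ false = 0

χ-∧ : ∀ a b → χ (a ∧ b) ≡ χ a * χ b
χ-∧ true  b = sym (+-identityʳ (χ b))
χ-∧ false b = refl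

χ≤1 : ∀ b → χ b ≤ 1
χ≤1 true  = s≤s z≤n
χ≤1 false = z≤n

does⇒ : ∀ {P : Set} (d : Dec P) → T (does d) → P
does⇒ (yes p) _ = p

does⇐ : ∀ {P : Set} (d : Dec P) → P → T (does d)
does⇐ (yes _) _ = _
does⇐ (no ¬p) p = ¬p p

χᵈ : ∀ {P : Set} → Dec P → ℕ
χᵈ d = χ (does d)

χᵈ-yes : ∀ {P : Set} (d : Dec P) → P → χᵈ d ≡ 1
χᵈ-yes (yes _) p = refl
χᵈ-yes (no ¬p) p = ⊥-elim (¬p p)

χᵈ-no : ∀ {P : Set} (d : Dec P) → ¬ P → χᵈ d ≡ 0
χᵈ-no (yes p) ¬p = ⊥-elim (¬p p)
χᵈ-no (no _)  ¬p = refl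

χᵈ-mono : ∀ {P Q : Set} → (P → Q) → (p : Dec P) (q : Dec Q) → χᵈ p ≤ χᵈ q
χᵈ-mono f (yes p) q = ≤-reflexive (sym (χᵈ-yes q (f p)))
χᵈ-mono f (no _)  q = z≤n

χᵈ-cong : ∀ {P Q : Set} → (P → Q) → (Q → P) → (p : Dec P) (q : Dec Q) → χᵈ p ≡ χᵈ q
χᵈ-cong f g p q = ≤-antisym (χᵈ-mono f p q) (χᵈ-mono g q p)

χᵈ-× : ∀ {P Q : Set} (p : Dec P) (q : Dec Q) → χᵈ (p ×-dec q) ≡ χᵈ p * χᵈ q
χᵈ-× (yes p) q = sym (+-identityʳ (χᵈ q))
χᵈ-× (no ¬p) q = refl

χ-mono : ∀ {P : Set} b → (T b → P) → (d : Dec P) → χ b ≤ χᵈ d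
χ-mono true  b⇒P d = ≤-reflexive (sym (χᵈ-yes d (b⇒P _)))
χ-mono false b⇒P d = z≤n

length-allFin : ∀ n → length (L.allFin n) ≡ n
length-allFin n = ListP.length-tabulate (λ i → i)

∑-tabulate : ∀ m (f : Fin m → A) (g : A → ℕ) → ∑ (L.tabulate f) g ≡ ∑ (L.allFin m) (λ i → g (f i))
∑-tabulate zero    f g = refl
∑-tabulate (suc m) f g = cong (g (f zero) +_) (trans (∑-tabulate m (f ∘ suc) g) (sym (∑-tabulate m suc (g ∘ f))))

∑-allFin-suc : ∀ m (g : Fin (suc m) → ℕ) → ∑ (L.allFin (suc m)) g ≡ g zero + ∑ (L.allFin m) (g ∘ suc)
∑-allFin-suc m g = cong (g zero +_) (∑-tabulate m suc g)

∑-allFin-≡ : ∀ n (c : Fin n) → ∑ (L.allFin n) (λ a → χᵈ (a Fin.≟ c)) ≡ 1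
∑-allFin-≡ (suc n) zero = begin
  ∑ (L.allFin (suc n)) (λ a → χᵈ (a Fin.≟ zero))    ≡⟨ ∑-allFin-suc n (λ a → χᵈ (a Fin.≟ zero)) ⟩
  1 + ∑ (L.allFin n) (λ a → χᵈ (suc a Fin.≟ zero))  ≡⟨ cong suc (∑-cong (L.allFin n) (λ a → χᵈ-no (suc a Fin.≟ zero) (λ ())) ) ⟩
  1 + ∑ (L.allFin n) (λ _ → 0)                      ≡⟨ cong suc (∑-zero (L.allFin n)) ⟩
  1                                                 ∎
  where open ≡-Reasoning
∑-allFin-≡ (suc n) (suc c) = begin
  ∑ (L.allFin (suc n)) (λ a → χᵈ (a Fin.≟ suc c))   ≡⟨ ∑-allFin-suc n (λ a → χᵈ (a Fin.≟ suc c)) ⟩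
  ∑ (L.allFin n) (λ a → χᵈ (suc a Fin.≟ suc c))
    ≡⟨ ∑-cong (L.allFin n) (λ a → χᵈ-cong FinP.suc-injective (cong suc) (suc a Fin.≟ suc c) (a Fin.≟ c)) ⟩
  ∑ (L.allFin n) (λ a → χᵈ (a Fin.≟ c))             ≡⟨ ∑-allFin-≡ n c ⟩
  1                                                 ∎
  where open ≡-Reasoning

∑-allFin-→ : ∀ {n} b {Q : Fin n → Set} (Q? : ∀ a → Dec (Q a)) →
  ∑ (L.allFin n) (λ a → χᵈ (T? b →-dec Q? a)) ≡ (if b then ∑ (L.allFin n) (λ a → χᵈ (Q? a)) else n)
∑-allFin-→ {n} true  Q? = ∑-cong (L.allFin n) (λ a → χᵈ-cong (λ f → f _) (λ q _ → q) (T? true →-dec Q? a) (Q? a))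
∑-allFin-→ {n} false Q? = begin
  ∑ (L.allFin n) (λ a → χᵈ (T? false →-dec Q? a)) ≡⟨ ∑-cong (L.allFin n) (λ a → χᵈ-yes (T? false →-dec Q? a) (λ ())) ⟩
  ∑ (L.allFin n) (λ _ → 1)                        ≡⟨ length≡∑1 (L.allFin n) ⟨
  length (L.allFin n)                             ≡⟨ length-allFin n ⟩
  n                                               ∎
  where open ≡-Reasoning

∑-allFin-∈ : ∀ {n} (ws : List (Fin n)) → ∑ (L.allFin n) (λ w → χᵈ (Any.any? (w Fin.≟_) ws)) ≤ length ws
∑-allFin-∈ {n} []       = ≤-reflexive (trans (∑-cong (L.allFin n) (λ w → χᵈ-no (Any.any? (w Fin.≟_) []) (λ ()))) (∑-zero (L.allFin n)))
∑-allFin-∈ {n} (y ∷ ws) = begin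
  ∑ (L.allFin n) (λ w → χᵈ (Any.any? (w Fin.≟_) (y ∷ ws)))
    ≤⟨ ∑-mono-≤ (L.allFin n) split ⟩
  ∑ (L.allFin n) (λ w → χᵈ (w Fin.≟ y) + χᵈ (Any.any? (w Fin.≟_) ws))
    ≡⟨ ∑-distrib-+ (L.allFin n) _ _ ⟩
  ∑ (L.allFin n) (λ w → χᵈ (w Fin.≟ y)) + ∑ (L.allFin n) (λ w → χᵈ (Any.any? (w Fin.≟_) ws))
    ≤⟨ +-mono-≤ (≤-reflexive (∑-allFin-≡ n y)) (∑-allFin-∈ ws) ⟩
  1 + length ws ∎
  where
  open ≤-Reasoning
  split : ∀ w → χᵈ (Any.any? (w Fin.≟_) (y ∷ ws)) ≤ χᵈ (w Fin.≟ y) + χᵈ (Any.any? (w Fin.≟_) ws)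
  split w with w Fin.≟ y
  ... | yes _ = s≤s z≤n
  ... | no _  = ≤-refl

∏ : ∀ m → (Fin m → ℕ) → ℕ
∏ zero    f = 1
∏ (suc m) f = f zero * ∏ m (f ∘ suc)

∏-mono-≤ : ∀ m {f g : Fin m → ℕ} → (∀ i → f i ≤ g i) → ∏ m f ≤ ∏ m g
∏-mono-≤ zero    f≤g = ≤-refl
∏-mono-≤ (suc m) f≤g = *-mono-≤ (f≤g zero) (∏-mono-≤ m (f≤g ∘ suc))

∏-cong : ∀ m {f g : Fin m → ℕ} → (∀ i → f i ≡ g i) → ∏ m f ≡ ∏ m g
∏-cong m f≡g = ≤-antisym (∏-mono-≤ m (≤-reflexive ∘ f≡g)) (∏-mono-≤ m (≤-reflexive ∘ sym ∘ f≡g))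

countTrue countFalse : ∀ m → (Fin m → Bool) → ℕ
countTrue  m p = ∑ (L.allFin m) (λ i → χ (p i))
countFalse m p = ∑ (L.allFin m) (λ i → χ (not (p i)))

countTrue+countFalse : ∀ m (p : Fin m → Bool) → countTrue m p + countFalse m p ≡ m
countTrue+countFalse m p = begin
  countTrue m p + countFalse m p                  ≡⟨ ∑-distrib-+ (L.allFin m) _ _ ⟨
  ∑ (L.allFin m) (λ i → χ (p i) + χ (not (p i)))  ≡⟨ ∑-cong (L.allFin m) (λ i → χ+χ∘not (p i)) ⟩
  ∑ (L.allFin m) (λ _ → 1)                        ≡⟨ length≡∑1 (L.allFin m) ⟨
  length (L.allFin m)                             ≡⟨ length-allFin m ⟩
  m                                               ∎
  where
  open ≡-Reasoning
  χ+χ∘not : ∀ b → χ b + χ (not b) ≡ 1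
  χ+χ∘not true  = refl
  χ+χ∘not false = refl

∏-if : ∀ m (p : Fin m → Bool) c d → ∏ m (λ i → if p i then c else d) ≡ c ^ countTrue m p * d ^ countFalse m p
∏-if zero    p c d = refl
∏-if (suc m) p c d
  rewrite ∑-allFin-suc m (λ i → χ (p i)) | ∑-allFin-suc m (λ i → χ (not (p i))) | ∏-if m (p ∘ suc) c d
  with p zero
... | true  = sym (*-assoc c (c ^ countTrue m (p ∘ suc)) _)
... | false = x*[y*z]≡y*[x*z] d (c ^ countTrue m (p ∘ suc)) (d ^ countFalse m (p ∘ suc))
  where
  x*[y*z]≡y*[x*z] : ∀ x y z → x * (y * z) ≡ y * (x * z)
  x*[y*z]≡y*[x*z] = solve-∀

length-filterᵇ : ∀ (p : A → Bool) xs → length (L.filterᵇ p xs) ≡ ∑ xs (λ x → χ (p x))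
length-filterᵇ p []       = refl
length-filterᵇ p (x ∷ xs) with p x
... | true  = cong suc (length-filterᵇ p xs)
... | false = length-filterᵇ p xs

allVecs : ∀ n m → List (Vec (Fin n) m)
allVecs n zero    = [] ∷ []
allVecs n (suc m) = cartesianProductWith _∷_ (L.allFin n) (allVecs n m)

∑-allVecs-suc : ∀ n m (f : Vec (Fin n) (suc m) → ℕ) →
  ∑ (allVecs n (suc m)) f ≡ ∑ (L.allFin n) (λ a → ∑ (allVecs n m) (λ y → f (a ∷ y)))
∑-allVecs-suc n m = ∑-cartesianProductWith _∷_ (L.allFin n) (allVecs n m)

length-allVecs : ∀ n m → length (allVecs n m) ≡ n ^ m
length-allVecs n zero    = refl
length-allVecs n (suc m) = begin
  length (allVecs n (suc m))                           ≡⟨ length≡∑1 (allVecs n (suc m)) ⟩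
  ∑ (allVecs n (suc m)) (λ _ → 1)                      ≡⟨ ∑-allVecs-suc n m (λ _ → 1) ⟩
  ∑ (L.allFin n) (λ a → ∑ (allVecs n m) (λ _ → 1))     ≡⟨ ∑-const (L.allFin n) _ ⟩
  length (L.allFin n) * ∑ (allVecs n m) (λ _ → 1)      ≡⟨ cong₂ _*_ (length-allFin n) (sym (length≡∑1 (allVecs n m))) ⟩
  n * length (allVecs n m)                             ≡⟨ cong (n *_) (length-allVecs n m) ⟩
  n * n ^ m                                            ∎
  where open ≡-Reasoning

length-cartesianProduct : ∀ (xs : List A) (ys : List B) → length (cartesianProduct xs ys) ≡ length xs * length ys
length-cartesianProduct xs ys = begin
  length (cartesianProduct xs ys)             ≡⟨ length≡∑1 (cartesianProduct xs ys) ⟩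
  ∑ (cartesianProduct xs ys) (λ _ → 1)        ≡⟨ ∑-cartesianProductWith _,_ xs ys (λ _ → 1) ⟩
  ∑ xs (λ _ → ∑ ys (λ _ → 1))                 ≡⟨ ∑-const xs _ ⟩
  length xs * ∑ ys (λ _ → 1)                  ≡⟨ cong (length xs *_) (length≡∑1 ys) ⟨
  length xs * length ys                       ∎
  where open ≡-Reasoning

∑-allVecs-∀ : ∀ {n} m (Q : Fin m → Fin n → Set) (Q? : ∀ i a → Dec (Q i a)) →
  ∑ (allVecs n m) (λ y → χᵈ (FinP.all? (λ i → Q? i (lookup y i)))) ≡ ∏ m (λ i → ∑ (L.allFin n) (λ a → χᵈ (Q? i a)))
∑-allVecs-∀ {n} zero    Q Q? = refl
∑-allVecs-∀ {n} (suc m) Q Q? = begin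
  ∑ (allVecs n (suc m)) (λ y → χᵈ (FinP.all? (λ i → Q? i (lookup y i))))
    ≡⟨ ∑-allVecs-suc n m _ ⟩
  ∑ Fn (λ a → ∑ V (λ y → χᵈ (FinP.all? (λ i → Q? i (lookup (a ∷ y) i)))))
    ≡⟨ ∑-cong Fn (λ a → ∑-cong V (χᵈ-all-∷ a)) ⟩
  ∑ Fn (λ a → ∑ V (λ y → χᵈ (Q? zero a) * χᵈ (rest y)))
    ≡⟨ ∑-cong Fn (λ a → ∑-*ˡ V (χᵈ (Q? zero a)) _) ⟨
  ∑ Fn (λ a → χᵈ (Q? zero a) * ∑ V (λ y → χᵈ (rest y)))
    ≡⟨ ∑-*ʳ Fn _ _ ⟨
  ∑ Fn (λ a → χᵈ (Q? zero a)) * ∑ V (λ y → χᵈ (rest y))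
    ≡⟨ cong (∑ Fn (λ a → χᵈ (Q? zero a)) *_) (∑-allVecs-∀ m (Q ∘ suc) (Q? ∘ suc)) ⟩
  ∏ (suc m) (λ i → ∑ Fn (λ a → χᵈ (Q? i a))) ∎
  where
  open ≡-Reasoning
  Fn : List (Fin n)
  Fn = L.allFin n
  V : List (Vec (Fin n) m)
  V = allVecs n m
  rest : (y : Vec (Fin n) m) → Dec (∀ i → Q (suc i) (lookup y i))
  rest y = FinP.all? (λ i → Q? (suc i) (lookup y i))
  uncons : ∀ {a y} → (∀ i → Q i (lookup (a ∷ y) i)) → Q zero a × (∀ i → Q (suc i) (lookup y i))
  uncons h = h zero , h ∘ suc
  cons : ∀ {a y} → Q zero a → (∀ i → Q (suc i) (lookup y i)) → ∀ i → Q i (lookup (a ∷ y) i)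
  cons h₀ h zero    = h₀
  cons h₀ h (suc i) = h i
  χᵈ-all-∷ : ∀ a y → χᵈ (FinP.all? (λ i → Q? i (lookup (a ∷ y) i))) ≡ χᵈ (Q? zero a) * χᵈ (rest y)
  χᵈ-all-∷ a y = trans (χᵈ-cong uncons (uncurry cons) (FinP.all? (λ i → Q? i (lookup (a ∷ y) i))) (Q? zero a ×-dec rest y))
                       (χᵈ-× (Q? zero a) (rest y))

∑-allVecs-lookup : ∀ n m (j : Fin m) (c : Fin n) → n * ∑ (allVecs n m) (λ y → χᵈ (lookup y j Fin.≟ c)) ≡ n ^ m
∑-allVecs-lookup n (suc m) zero c = begin
  n * ∑ (allVecs n (suc m)) (λ y → χᵈ (lookup y zero Fin.≟ c)) ≡⟨ cong (n *_) (∑-allVecs-suc n m _) ⟩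
  n * ∑ Fn (λ a → ∑ V (λ _ → χᵈ (a Fin.≟ c)))
    ≡⟨ cong (n *_) (∑-cong Fn (λ a → trans (∑-const V _) (*-comm (length V) _))) ⟩
  n * ∑ Fn (λ a → χᵈ (a Fin.≟ c) * length V)                   ≡⟨ cong (n *_) (∑-*ʳ Fn _ (length V)) ⟨
  n * (∑ Fn (λ a → χᵈ (a Fin.≟ c)) * length V)
    ≡⟨ cong₂ (λ u w → n * (u * w)) (∑-allFin-≡ n c) (length-allVecs n m) ⟩
  n * (1 * n ^ m)                                              ≡⟨ cong (n *_) (*-identityˡ (n ^ m)) ⟩
  n ^ suc m                                                    ∎
  where
  open ≡-Reasoning
  Fn : List (Fin n)
  Fn = L.allFin n
  V : List (Vec (Fin n) m)
  V = allVecs n m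
∑-allVecs-lookup n (suc m) (suc j) c = begin
  n * ∑ (allVecs n (suc m)) (λ y → χᵈ (lookup y (suc j) Fin.≟ c)) ≡⟨ cong (n *_) (∑-allVecs-suc n m _) ⟩
  n * ∑ Fn (λ _ → ∑ V (λ y → χᵈ (lookup y j Fin.≟ c)))            ≡⟨ cong (n *_) (∑-const Fn _) ⟩
  n * (length Fn * ∑ V (λ y → χᵈ (lookup y j Fin.≟ c)))
    ≡⟨ cong (λ z → n * (z * ∑ V (λ y → χᵈ (lookup y j Fin.≟ c)))) (length-allFin n) ⟩
  n * (n * ∑ V (λ y → χᵈ (lookup y j Fin.≟ c)))                   ≡⟨ cong (n *_) (∑-allVecs-lookup n m j c) ⟩
  n ^ suc m                                                       ∎
  where
  open ≡-Reasoning
  Fn : List (Fin n)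
  Fn = L.allFin n
  V : List (Vec (Fin n) m)
  V = allVecs n m

-- The box inequality

corner : ∀ {m} → Vec Bool m → Vec A m → Vec A m → Vec A m
corner []       []      []       = []
corner (s ∷ ss) (a ∷ x) (b ∷ x′) = (if s then b else a) ∷ corner ss x x′

all-pairs : ∀ (p : B → Bool) (f g : A → B) (xs : List A) →
  all p (concatMap (λ s → f s ∷ g s ∷ []) xs) ≡ all (λ s → p (f s) ∧ p (g s)) xs
all-pairs p f g []       = refl
all-pairs p f g (x ∷ xs) = trans (cong (λ z → p (f x) ∧ (p (g x) ∧ z)) (all-pairs p f g xs))
                                 (sym (∧-assoc (p (f x)) (p (g x)) _))

all-∈ : ∀ (p : A → Bool) xs → T (all p xs) → ∀ {x} → x ∈ xs → T (p x)
all-∈ p (y ∷ xs) t (here refl) with p y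
... | true = _
all-∈ p (y ∷ xs) t (there x∈) with p y
... | true = all-∈ p xs t x∈

box-count-lhs-suc : ∀ c n m → c ^ (2 ^ suc m) * n ^ (suc m + suc m) ≡ (c * c) ^ (2 ^ m) * n ^ (m + m) * (n * n)
box-count-lhs-suc c n m = begin
  c ^ (2 * 2 ^ m) * n ^ (suc m + suc m)      ≡⟨ cong₂ (λ u w → u * n ^ w) (^-*-assoc c 2 (2 ^ m)) (cong suc (sym (+-suc m m))) ⟨
  (c ^ 2) ^ (2 ^ m) * (n * (n * n ^ (m + m))) ≡⟨ cong (λ z → z ^ (2 ^ m) * (n * (n * n ^ (m + m)))) (cong (c *_) (*-identityʳ c)) ⟩
  (c * c) ^ (2 ^ m) * (n * (n * n ^ (m + m))) ≡⟨ shuffle ((c * c) ^ (2 ^ m)) n (n ^ (m + m)) ⟩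
  (c * c) ^ (2 ^ m) * n ^ (m + m) * (n * n)   ∎
  where
  open ≡-Reasoning
  shuffle : ∀ a n e → a * (n * (n * e)) ≡ a * e * (n * n)
  shuffle = solve-∀

box-count-rhs-suc : ∀ n m b → (n ^ m) ^ (2 ^ m) * (n * n) ^ (2 ^ m) * (b * n ^ (m * 2 ^ m)) ≡ b * n ^ (suc m * 2 ^ suc m)
box-count-rhs-suc n m b = begin
  (n ^ m) ^ P * (n * n) ^ P * (b * n ^ (m * P))
    ≡⟨ cong₂ (λ u w → u * w * (b * n ^ (m * P))) (^-*-assoc n m P) (^-distrib-* n n P) ⟩
  n ^ (m * P) * (n ^ P * n ^ P) * (b * n ^ (m * P))
    ≡⟨ shuffle (n ^ (m * P)) (n ^ P) b ⟩
  b * (n ^ (m * P) * n ^ P * n ^ P * n ^ (m * P))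
    ≡⟨ cong (b *_) (^-distribˡ-+₄ n (m * P) P P (m * P)) ⟨
  b * n ^ (m * P + P + P + m * P)
    ≡⟨ cong (λ z → b * n ^ z) (exponent m P) ⟩
  b * n ^ (suc m * (2 * P)) ∎
  where
  open ≡-Reasoning
  P : ℕ
  P = 2 ^ m
  shuffle : ∀ a p b → a * (p * p) * (b * a) ≡ b * (a * p * p * a)
  shuffle = solve-∀
  exponent : ∀ m P → m * P + P + P + m * P ≡ suc m * (2 * P)
  exponent = solve-∀

module _ {n : ℕ} where

  count : ∀ {m} → (Vec (Fin n) m → Bool) → ℕ
  count {m} H = ∑ (allVecs n m) (λ y → χ (H y))

  boxIn : ∀ {m} → (Vec (Fin n) m → Bool) → Vec (Fin n) m → Vec (Fin n) m → Bool
  boxIn {m} H x x′ = all (λ s → H (corner s x x′)) (allBools m)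

  boxes : ∀ {m} → (Vec (Fin n) m → Bool) → ℕ
  boxes {m} H = ∑ (allVecs n m) (λ x → ∑ (allVecs n m) (λ x′ → χ (boxIn H x x′)))

  allPairs : List (Fin n × Fin n)
  allPairs = cartesianProduct (L.allFin n) (L.allFin n)

  length-allPairs : length allPairs ≡ n * n
  length-allPairs = trans (length-cartesianProduct (L.allFin n) (L.allFin n)) (cong₂ _*_ (length-allFin n) (length-allFin n))

  both : ∀ {m} → (Vec (Fin n) (suc m) → Bool) → Fin n × Fin n → Vec (Fin n) m → Bool
  both H (a , b) y = H (a ∷ y) ∧ H (b ∷ y)

  boxIn-∷ : ∀ {m} (H : Vec (Fin n) (suc m) → Bool) a b y y′ →
    boxIn H (a ∷ y) (b ∷ y′) ≡ boxIn (both H (a , b)) y y′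
  boxIn-∷ {m} H a b y y′ = all-pairs (λ s → H (corner s (a ∷ y) (b ∷ y′))) (false ∷_) (true ∷_) (allBools m)

  boxes-suc : ∀ {m} (H : Vec (Fin n) (suc m) → Bool) → boxes H ≡ ∑ allPairs (λ ab → boxes (both H ab))
  boxes-suc {m} H = begin
    boxes H
      ≡⟨ ∑-allVecs-suc n m _ ⟩
    ∑ Fn (λ a → ∑ V (λ y → ∑ (allVecs n (suc m)) (λ x′ → χ (boxIn H (a ∷ y) x′))))
      ≡⟨ ∑-cong Fn (λ a → ∑-cong V (λ y → ∑-allVecs-suc n m _)) ⟩
    ∑ Fn (λ a → ∑ V (λ y → ∑ Fn (λ b → ∑ V (λ y′ → χ (boxIn H (a ∷ y) (b ∷ y′))))))
      ≡⟨ ∑-cong Fn (λ a → ∑-cong V (λ y → ∑-cong Fn (λ b → ∑-cong V (λ y′ → cong χ (boxIn-∷ H a b y y′))))) ⟩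
    ∑ Fn (λ a → ∑ V (λ y → ∑ Fn (λ b → ∑ V (λ y′ → χ (boxIn (both H (a , b)) y y′)))))
      ≡⟨ ∑-cong Fn (λ a → ∑-comm V Fn _) ⟩
    ∑ Fn (λ a → ∑ Fn (λ b → boxes (both H (a , b))))
      ≡⟨ ∑-cartesianProductWith _,_ Fn Fn _ ⟨
    ∑ allPairs (λ ab → boxes (both H ab)) ∎
    where
    open ≡-Reasoning
    Fn : List (Fin n)
    Fn = L.allFin n
    V : List (Vec (Fin n) m)
    V = allVecs n m

  count²≤ : ∀ {m} (H : Vec (Fin n) (suc m) → Bool) → count H * count H ≤ n ^ m * ∑ allPairs (λ ab → count (both H ab))
  count²≤ {m} H = begin
    count H * count H                       ≡⟨ cong₂ _*_ count≡∑column count≡∑column ⟩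
    ∑ V column * ∑ V column                 ≤⟨ cauchy-schwarz V column ⟩
    length V * ∑ V (λ y → column y * column y)
      ≡⟨ cong₂ _*_ (length-allVecs n m) (∑-cong V (λ y → ∑-square Fn (λ a → χ (H (a ∷ y))))) ⟩
    n ^ m * ∑ V (λ y → ∑ Fn (λ a → ∑ Fn (λ b → χ (H (a ∷ y)) * χ (H (b ∷ y)))))
      ≡⟨ cong (n ^ m *_) (∑-cong V (λ y → ∑-cong Fn (λ a → ∑-cong Fn (λ b → χ-∧ (H (a ∷ y)) (H (b ∷ y)))))) ⟨
    n ^ m * ∑ V (λ y → ∑ Fn (λ a → ∑ Fn (λ b → χ (both H (a , b) y))))
      ≡⟨ cong (n ^ m *_) (trans (∑-comm V Fn _) (∑-cong Fn (λ a → ∑-comm V Fn _))) ⟩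
    n ^ m * ∑ Fn (λ a → ∑ Fn (λ b → count (both H (a , b))))
      ≡⟨ cong (n ^ m *_) (∑-cartesianProductWith _,_ Fn Fn _) ⟨
    n ^ m * ∑ allPairs (λ ab → count (both H ab)) ∎
    where
    open ≤-Reasoning
    Fn : List (Fin n)
    Fn = L.allFin n
    V : List (Vec (Fin n) m)
    V = allVecs n m
    column : Vec (Fin n) m → ℕ
    column y = ∑ Fn (λ a → χ (H (a ∷ y)))
    count≡∑column : count H ≡ ∑ V column
    count≡∑column = trans (∑-allVecs-suc n m _) (∑-comm Fn V _)

  -- |H|^(2^m) ≤ boxes H · n^(m 2^m - 2m), multiplied through by n^(2m).
  box-count : ∀ m (H : Vec (Fin n) m → Bool) →
    count H ^ (2 ^ m) * n ^ (m + m) ≤ boxes H * n ^ (m * 2 ^ m)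
  box-count zero H = base (H [])
    where
    base : ∀ b → (χ b + 0) ^ 1 * 1 ≤ (χ (b ∧ true) + 0 + 0) * 1
    base true  = s≤s z≤n
    base false = z≤n
  box-count (suc m) H = begin
    count H ^ (2 ^ suc m) * n ^ (suc m + suc m)
      ≡⟨ box-count-lhs-suc (count H) n m ⟩
    (count H * count H) ^ P * e * (n * n)
      ≤⟨ *-monoˡ-≤ (n * n) (*-monoˡ-≤ e (^-monoˡ-≤ P (count²≤ H))) ⟩
    (n ^ m * S) ^ P * e * (n * n)
      ≡⟨ cong (λ z → z * e * (n * n)) (^-distrib-* (n ^ m) S P) ⟩
    (n ^ m) ^ P * S ^ P * e * (n * n)
      ≡⟨ rearrange₁ ((n ^ m) ^ P) (S ^ P) e (n * n) ⟩
    (n ^ m) ^ P * (S ^ P * (n * n)) * e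
      ≤⟨ *-monoˡ-≤ e (*-monoʳ-≤ ((n ^ m) ^ P) (subst (λ N → S ^ P * N ≤ N ^ P * ∑ allPairs (λ ab → g ab ^ P))
                                                       length-allPairs (power-mean allPairs g m))) ⟩
    (n ^ m) ^ P * ((n * n) ^ P * ∑ allPairs (λ ab → g ab ^ P)) * e
      ≡⟨ rearrange₂ ((n ^ m) ^ P) ((n * n) ^ P) (∑ allPairs (λ ab → g ab ^ P)) e ⟩
    (n ^ m) ^ P * (n * n) ^ P * (∑ allPairs (λ ab → g ab ^ P) * e)
      ≡⟨ cong ((n ^ m) ^ P * (n * n) ^ P *_) (∑-*ʳ allPairs (λ ab → g ab ^ P) e) ⟩
    (n ^ m) ^ P * (n * n) ^ P * ∑ allPairs (λ ab → g ab ^ P * e)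
      ≤⟨ *-monoʳ-≤ ((n ^ m) ^ P * (n * n) ^ P) (∑-mono-≤ allPairs (λ ab → box-count m (both H ab))) ⟩
    (n ^ m) ^ P * (n * n) ^ P * ∑ allPairs (λ ab → boxes (both H ab) * n ^ (m * P))
      ≡⟨ cong ((n ^ m) ^ P * (n * n) ^ P *_) (trans (cong (_* n ^ (m * P)) (boxes-suc H)) (∑-*ʳ allPairs _ _)) ⟨
    (n ^ m) ^ P * (n * n) ^ P * (boxes H * n ^ (m * P))
      ≡⟨ box-count-rhs-suc n m (boxes H) ⟩
    boxes H * n ^ (suc m * 2 ^ suc m) ∎
    where
    open ≤-Reasoning
    P e S : ℕ
    P = 2 ^ m
    e = n ^ (m + m)
    S = ∑ allPairs (λ ab → count (both H ab))
    g : Fin n × Fin n → ℕ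
    g ab = count (both H ab)
    rearrange₁ : ∀ a b c d → a * b * c * d ≡ a * (b * d) * c
    rearrange₁ = solve-∀
    rearrange₂ : ∀ a b c d → a * (b * c) * d ≡ a * b * (c * d)
    rearrange₂ = solve-∀

Occurs : ∀ {n} → Fin n → Clause n → Set
Occurs x c = T (is-just (lookup c x))

just⇒Occurs : ∀ {n} {c : Clause n} {x b} → lookup c x ≡ just b → Occurs x c
just⇒Occurs e rewrite e = _

Occurs⇒just : ∀ {n} {c : Clause n} {x} → Occurs x c → Σ Bool λ b → lookup c x ≡ just b
Occurs⇒just {c = c} {x} o with lookup c x
... | just b = b , refl

maybe-ext : ∀ {u v : Maybe A} → (∀ b → u ≡ just b → v ≡ just b) → (∀ b → v ≡ just b → u ≡ just b) → u ≡ v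
maybe-ext {u = just b}  {v}         u⇒v v⇒u = sym (u⇒v b refl)
maybe-ext {u = nothing} {v = just b} u⇒v v⇒u = v⇒u b refl
maybe-ext {u = nothing} {v = nothing} u⇒v v⇒u = refl

vec-ext : ∀ {n} {xs ys : Vec A n} → (∀ i → lookup xs i ≡ lookup ys i) → xs ≡ ys
vec-ext {xs = xs} {ys} h = trans (sym (VP.tabulate∘lookup xs)) (trans (VP.tabulate-cong h) (VP.tabulate∘lookup ys))

module _ {m n : ℕ} (φ : Fin m → Fin n) (c : Clause m) where

  private
    step : Fin m → Clause n → Clause n
    step x acc = maybe (λ b → acc V.[ φ x ]≔ just b) acc (lookup c x)

    renameOver : List (Fin m) → Clause n
    renameOver = L.foldr step (V.replicate n nothing)

    renameOver-just⇒ : ∀ xs {y b} → lookup (renameOver xs) y ≡ just b → Σ (Fin m) λ x → φ x ≡ y × lookup c x ≡ just b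
    renameOver-just⇒ [] {y} e with () ← trans (sym (VP.lookup-replicate y nothing)) e
    renameOver-just⇒ (x ∷ xs) {y} e with lookup c x in cx
    ... | nothing = renameOver-just⇒ xs e
    ... | just b′ with φ x Fin.≟ y
    ...   | yes refl = x , refl , trans cx (trans (sym (VP.lookup∘update (φ x) (renameOver xs) (just b′))) e)
    ...   | no φx≢y = renameOver-just⇒ xs (trans (sym (VP.lookup∘update′ (φx≢y ∘ sym) (renameOver xs) (just b′))) e)

    renameOver-just⇐ : ∀ xs {x b} → (∀ x′ b′ → φ x′ ≡ φ x → lookup c x′ ≡ just b′ → b′ ≡ b) →
      x ∈ xs → lookup c x ≡ just b → lookup (renameOver xs) (φ x) ≡ just b
    renameOver-just⇐ (x ∷ xs) unique (here refl) cx rewrite cx = VP.lookup∘update (φ x) (renameOver xs) (just _)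
    renameOver-just⇐ (x′ ∷ xs) {x} {b} unique (there x∈xs) cx with lookup c x′ in cx′
    ... | nothing = renameOver-just⇐ xs unique x∈xs cx
    ... | just b′ with φ x′ Fin.≟ φ x
    ...   | no φx′≢φx =
      trans (VP.lookup∘update′ (φx′≢φx ∘ sym) (renameOver xs) (just b′)) (renameOver-just⇐ xs unique x∈xs cx)
    ...   | yes φx′≡φx = begin
      lookup (renameOver xs V.[ φ x′ ]≔ just b′) (φ x) ≡⟨ cong (lookup (renameOver xs V.[ φ x′ ]≔ just b′)) φx′≡φx ⟨
      lookup (renameOver xs V.[ φ x′ ]≔ just b′) (φ x′) ≡⟨ VP.lookup∘update (φ x′) (renameOver xs) (just b′) ⟩
      just b′                                           ≡⟨ cong just (unique x′ b′ φx′≡φx cx′) ⟩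
      just b                                            ∎
      where open ≡-Reasoning

    renameOver-cong : ∀ (ψ : Fin m → Fin n) → (∀ x → Occurs x c → φ x ≡ ψ x) → ∀ xs →
      renameOver xs ≡ L.foldr (λ x acc → maybe (λ b → acc V.[ ψ x ]≔ just b) acc (lookup c x)) (V.replicate n nothing) xs
    renameOver-cong ψ φ≗ψ []       = refl
    renameOver-cong ψ φ≗ψ (x ∷ xs) with lookup c x in cx
    ... | nothing = renameOver-cong ψ φ≗ψ xs
    ... | just b  = cong₂ (λ acc i → acc V.[ i ]≔ just b) (renameOver-cong ψ φ≗ψ xs) (φ≗ψ x (just⇒Occurs {c = c} cx))

  rename-cong : ∀ (ψ : Fin m → Fin n) → (∀ x → Occurs x c → φ x ≡ ψ x) → rename φ c ≡ rename ψ c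
  rename-cong ψ φ≗ψ = renameOver-cong ψ φ≗ψ (L.allFin m)

  rename-just⇒ : ∀ {y b} → lookup (rename φ c) y ≡ just b → Σ (Fin m) λ x → φ x ≡ y × lookup c x ≡ just b
  rename-just⇒ = renameOver-just⇒ (L.allFin m)

  rename-just⇐ : ∀ {x b} → (∀ x′ b′ → φ x′ ≡ φ x → lookup c x′ ≡ just b′ → b′ ≡ b) →
    lookup c x ≡ just b → lookup (rename φ c) (φ x) ≡ just b
  rename-just⇐ unique = renameOver-just⇐ (L.allFin m) unique (∈-allFin _)

appears⁺ : ∀ {m} (F : Formula m) {c x} → c ∈ F → Occurs x c → T (appears F x)
appears⁺ F c∈F x∈c = AnyP.any⁺ _ (lose c∈F x∈c)

appears⁻ : ∀ {m} (F : Formula m) {x} → T (appears F x) → Σ (Clause m) λ c → c ∈ F × Occurs x c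
appears⁻ F t = find (AnyP.any⁻ _ F t)

same-image⇒same-sign : ∀ {m n} (F : Formula m) {φ : Fin m → Fin n} {c i i′ β β′} → InjectiveOnVars F φ → c ∈ F →
  φ i′ ≡ φ i → lookup c i′ ≡ just β′ → lookup c i ≡ just β → β′ ≡ β
same-image⇒same-sign F {c = c} {i} {i′} φ-inj c∈F φi′≡φi ci′ ci
  with refl ← φ-inj i′ i (appears⁺ F c∈F (just⇒Occurs {c = c} ci′)) (appears⁺ F c∈F (just⇒Occurs {c = c} ci)) φi′≡φi
  = MP.just-injective (trans (sym ci′) ci)

rename-just-injective : ∀ {m n} (F : Formula m) {φ : Fin m → Fin n} {c i β} → InjectiveOnVars F φ → c ∈ F →
  lookup c i ≡ just β → lookup (rename φ c) (φ i) ≡ just β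
rename-just-injective F {φ} {c} φ-inj c∈F ci =
  rename-just⇐ φ c (λ i′ β′ φi′≡φi ci′ → same-image⇒same-sign F φ-inj c∈F φi′≡φi ci′ ci) ci

select-⊆ : ∀ (xs : List A) S {c} → c ∈ select xs S → c ∈ xs
select-⊆ []       []            ()
select-⊆ (x ∷ xs) (true  ∷ S) (here refl) = here refl
select-⊆ (x ∷ xs) (true  ∷ S) (there c∈)  = there (select-⊆ xs S c∈)
select-⊆ (x ∷ xs) (false ∷ S) c∈          = there (select-⊆ xs S c∈)

selectionOf : ∀ (xs : List A) → (A → Bool) → Vec Bool (length xs)
selectionOf []       p = []
selectionOf (x ∷ xs) p = p x ∷ selectionOf xs p

∈-selectionOf⁺ : ∀ (xs : List A) (p : A → Bool) {c} → c ∈ xs → T (p c) → c ∈ select xs (selectionOf xs p)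
∈-selectionOf⁺ (x ∷ xs) p (here refl) t with p x
... | true = here refl
∈-selectionOf⁺ (x ∷ xs) p (there c∈) t with p x
... | true  = there (∈-selectionOf⁺ xs p c∈ t)
... | false = ∈-selectionOf⁺ xs p c∈ t

∈-selectionOf⁻ : ∀ (xs : List A) (p : A → Bool) {c} → c ∈ select xs (selectionOf xs p) → T (p c)
∈-selectionOf⁻ (x ∷ xs) p c∈ with p x in px
∈-selectionOf⁻ (x ∷ xs) p (here refl) | true rewrite px = _
∈-selectionOf⁻ (x ∷ xs) p (there c∈)  | true  = ∈-selectionOf⁻ xs p c∈
∈-selectionOf⁻ (x ∷ xs) p c∈          | false = ∈-selectionOf⁻ xs p c∈

select-injective : ∀ (xs : List A) → Unique xs → ∀ S S′ →
  (∀ c → c ∈ select xs S → c ∈ select xs S′) → (∀ c → c ∈ select xs S′ → c ∈ select xs S) → S ≡ S′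
select-injective []       _          []          []           _ _ = refl
select-injective (x ∷ xs) (x∉ ∷ uxs) (true ∷ S)  (true ∷ S′)  f g =
  cong (true ∷_) (select-injective xs uxs S S′ (drop-head S S′ f) (drop-head S′ S g))
  where
  drop-head : ∀ S S′ → (∀ c → c ∈ x ∷ select xs S → c ∈ x ∷ select xs S′) → ∀ c → c ∈ select xs S → c ∈ select xs S′
  drop-head S S′ f c c∈ with f c (there c∈)
  ... | here refl = ⊥-elim (All.lookup x∉ (select-⊆ xs S c∈) refl)
  ... | there c∈′ = c∈′
select-injective (x ∷ xs) (x∉ ∷ uxs) (false ∷ S) (false ∷ S′) f g = cong (false ∷_) (select-injective xs uxs S S′ f g)
select-injective (x ∷ xs) (x∉ ∷ uxs) (true ∷ S)  (false ∷ S′) f g = ⊥-elim (All.lookup x∉ (select-⊆ xs S′ (f x (here refl))) refl)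
select-injective (x ∷ xs) (x∉ ∷ uxs) (false ∷ S) (true ∷ S′)  f g = ⊥-elim (All.lookup x∉ (select-⊆ xs S (g x (here refl))) refl)

_≟ᶜ_ : ∀ {n} (c d : Clause n) → Dec (c ≡ d)
_≟ᶜ_ = VP.≡-dec (MP.≡-dec _≟ᵇ_)

module Embeddings {m n : ℕ} (F : Formula m) (G : Formula n) where

  open import Data.List.Membership.DecPropositional (_≟ᶜ_ {n}) using (_∈?_)

  Embeds : Vec (Fin n) m → Set
  Embeds ψ = InjectiveOnVars F (lookup ψ) × All (λ c → rename (lookup ψ) c ∈ G) F

  embeds? : ∀ ψ → Dec (Embeds ψ)
  embeds? ψ = injective? ×-dec All.all? (λ c → rename (lookup ψ) c ∈? G) F
    where
    injective? : Dec (InjectiveOnVars F (lookup ψ))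
    injective? = FinP.all? λ x → FinP.all? λ y →
      T? (appears F x) →-dec (T? (appears F y) →-dec ((lookup ψ x Fin.≟ lookup ψ y) →-dec (x Fin.≟ y)))

  embeds : Vec (Fin n) m → Bool
  embeds ψ = does (embeds? ψ)

  Extends : (Fin m → Fin n) → Vec (Fin n) m → Set
  Extends φ ψ = ∀ i → T (appears F i) → lookup ψ i ≡ φ i

  extends? : ∀ φ ψ → Dec (Extends φ ψ)
  extends? φ ψ = FinP.all? (λ i → T? (appears F i) →-dec (lookup ψ i Fin.≟ φ i))

  map-rename-extends : ∀ φ ψ → Extends φ ψ → map (rename (lookup ψ)) F ≡ map (rename φ) F
  map-rename-extends φ ψ ψ⊇φ =
    ListP.map-cong-local (All.tabulate λ {c} c∈F → rename-cong (lookup ψ) c φ (λ x x∈c → ψ⊇φ x (appears⁺ F c∈F x∈c)))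

  copy⇒embeds : ∀ {S} → ((φ , _) : IsCopy F G S) → ∀ {ψ} → Extends φ ψ → Embeds ψ
  copy⇒embeds {S} (φ , φ-inj , φF≈S) {ψ} ψ⊇φ = ψ-inj , All.tabulate ψc∈G
    where
    ψ-inj : InjectiveOnVars F (lookup ψ)
    ψ-inj x y x∈F y∈F ψx≡ψy = φ-inj x y x∈F y∈F (trans (sym (ψ⊇φ x x∈F)) (trans ψx≡ψy (ψ⊇φ y y∈F)))
    ψc∈G : ∀ {c} → c ∈ F → rename (lookup ψ) c ∈ G
    ψc∈G {c} c∈F = select-⊆ G S (Equivalence.to (φF≈S (rename (lookup ψ) c))
      (subst (rename (lookup ψ) c ∈_) (map-rename-extends φ ψ ψ⊇φ) (∈-map⁺ (rename (lookup ψ)) c∈F)))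

  common-extension⇒≡ : Unique G → ∀ {S S′} → ((φ , _) : IsCopy F G S) → ((φ′ , _) : IsCopy F G S′) →
    ∀ {ψ} → Extends φ ψ → Extends φ′ ψ → S ≡ S′
  common-extension⇒≡ G! {S} {S′} (φ , _ , φF≈S) (φ′ , _ , φ′F≈S′) {ψ} ψ⊇φ ψ⊇φ′ =
    select-injective G G! S S′ (transfer φF≈S φ′F≈S′ ψ⊇φ ψ⊇φ′) (transfer φ′F≈S′ φF≈S ψ⊇φ′ ψ⊇φ)
    where
    transfer : ∀ {S S′ φ φ′} → map (rename φ) F ≈F select G S → map (rename φ′) F ≈F select G S′ →
      Extends φ ψ → Extends φ′ ψ → ∀ c → c ∈ select G S → c ∈ select G S′
    transfer {φ = φ} {φ′} φF≈S φ′F≈S′ ψ⊇φ ψ⊇φ′ c c∈S = Equivalence.to (φ′F≈S′ c)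
      (subst (c ∈_) (trans (sym (map-rename-extends φ ψ ψ⊇φ)) (map-rename-extends φ′ ψ ψ⊇φ′)) (Equivalence.from (φF≈S c) c∈S))

  unused : ℕ
  unused = countFalse m (appears F)

  -- ψ is free exactly on the variables of [m] not appearing in F.
  #extensions : ∀ φ → ∑ (allVecs n m) (λ ψ → χᵈ (extends? φ ψ)) ≡ n ^ unused
  #extensions φ = begin
    ∑ (allVecs n m) (λ ψ → χᵈ (extends? φ ψ))
      ≡⟨ ∑-allVecs-∀ m (λ i a → T (appears F i) → a ≡ φ i) (λ i a → T? (appears F i) →-dec (a Fin.≟ φ i)) ⟩
    ∏ m (λ i → ∑ (L.allFin n) (λ a → χᵈ (T? (appears F i) →-dec (a Fin.≟ φ i)))) ≡⟨ ∏-cong m choices ⟩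
    ∏ m (λ i → if appears F i then 1 else n)                                     ≡⟨ ∏-if m (appears F) 1 n ⟩
    1 ^ countTrue m (appears F) * n ^ unused
      ≡⟨ cong (_* n ^ unused) (^-zeroˡ (countTrue m (appears F))) ⟩
    1 * n ^ unused                                                               ≡⟨ *-identityˡ _ ⟩
    n ^ unused                                                                   ∎
    where
    open ≡-Reasoning
    choices : ∀ i → ∑ (L.allFin n) (λ a → χᵈ (T? (appears F i) →-dec (a Fin.≟ φ i))) ≡ (if appears F i then 1 else n)
    choices i with appears F i
    ... | true  = trans (∑-allFin-→ true (Fin._≟ φ i)) (∑-allFin-≡ n (φ i))
    ... | false = ∑-allFin-→ false (Fin._≟ φ i)

  extensions-disjoint : Unique G → ∀ {Ss} → Unique Ss → (copies : All (IsCopy F G) Ss) →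
    ∀ ψ → ∑ᴬ copies (λ cp → χᵈ (extends? (proj₁ cp) ψ)) ≤ χᵈ (embeds? ψ)
  extensions-disjoint G! []           []            ψ = z≤n
  extensions-disjoint G! (S∉Ss ∷ Ss!) (cp ∷ copies) ψ = first-or-rest (extends? (proj₁ cp) ψ)
    where
    first-or-rest : (d : Dec (Extends (proj₁ cp) ψ)) →
      χᵈ d + ∑ᴬ copies (λ cp′ → χᵈ (extends? (proj₁ cp′) ψ)) ≤ χᵈ (embeds? ψ)
    first-or-rest (no _)    = extensions-disjoint G! Ss! copies ψ
    first-or-rest (yes ψ⊇φ) =
      ≤-reflexive (trans (cong suc (others-zero S∉Ss copies)) (sym (χᵈ-yes (embeds? ψ) (copy⇒embeds cp {ψ} ψ⊇φ))))
      where
      others-zero : ∀ {Ss} → All (_ ≢_) Ss → (copies : All (IsCopy F G) Ss) →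
        ∑ᴬ copies (λ cp′ → χᵈ (extends? (proj₁ cp′) ψ)) ≡ 0
      others-zero []           []             = refl
      others-zero (S≢S′ ∷ S≢) (cp′ ∷ copies) =
        cong₂ _+_ (χᵈ-no (extends? (proj₁ cp′) ψ) (λ ψ⊇φ′ → S≢S′ (common-extension⇒≡ G! cp cp′ {ψ} ψ⊇φ ψ⊇φ′)))
                  (others-zero S≢ copies)

  copies*n^unused≤embeddings : Unique G → ∀ {Ss} → Unique Ss → All (IsCopy F G) Ss → length Ss * n ^ unused ≤ count embeds
  copies*n^unused≤embeddings G! {Ss} Ss! copies = begin
    length Ss * n ^ unused                                                 ≡⟨ ∑ᴬ-const copies (n ^ unused) ⟨
    ∑ᴬ copies (λ _ → n ^ unused)                                           ≡⟨ ∑ᴬ-cong copies (λ cp → #extensions (proj₁ cp)) ⟨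
    ∑ᴬ copies (λ cp → ∑ (allVecs n m) (λ ψ → χᵈ (extends? (proj₁ cp) ψ)))  ≡⟨ ∑-∑ᴬ-comm (allVecs n m) copies _ ⟨
    ∑ (allVecs n m) (λ ψ → ∑ᴬ copies (λ cp → χᵈ (extends? (proj₁ cp) ψ)))
      ≤⟨ ∑-mono-≤ (allVecs n m) (extensions-disjoint G! Ss! copies) ⟩
    count embeds                                                            ∎
    where open ≤-Reasoning

-- The duplicates of variable i, in the block layout of dupClause: dup false i = i, dup true i = i′.
dup : ∀ {m} → Bool → Fin m → Fin (m + m)
dup {m} false i = i ↑ˡ m
dup {m} true  i = m ↑ʳ i

data DupView (m : ℕ) : Fin (m + m) → Set where
  dup-of : ∀ b i → DupView m (dup {m} b i)

dupView : ∀ m z → DupView m z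
dupView m z = subst (DupView m) (FinP.join-splitAt m m z) (view (Fin.splitAt m z))
  where
  view : ∀ (s : Fin m ⊎ Fin m) → DupView m (Fin.join m m s)
  view (inj₁ i) = dup-of false i
  view (inj₂ i) = dup-of true i

lookup-++-dup : ∀ {m} (x x′ : Vec A m) b i → lookup (x V.++ x′) (dup b i) ≡ (if b then lookup x′ i else lookup x i)
lookup-++-dup x x′ false i = VP.lookup-++ˡ x x′ i
lookup-++-dup x x′ true  i = VP.lookup-++ʳ x x′ i

lookup-corner : ∀ {m} (s : Vec Bool m) (x x′ : Vec A m) i → lookup (corner s x x′) i ≡ (if lookup s i then lookup x′ i else lookup x i)
lookup-corner (s ∷ ss) (a ∷ x) (b ∷ x′) zero    = refl
lookup-corner (s ∷ ss) (a ∷ x) (b ∷ x′) (suc i) = lookup-corner ss x x′ i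

lookup-++-corner : ∀ {m} (s : Vec Bool m) (x x′ : Vec A m) {b} i → lookup s i ≡ b →
  lookup (x V.++ x′) (dup b i) ≡ lookup (corner s x x′) i
lookup-++-corner s x x′ {b} i refl = trans (lookup-++-dup x x′ (lookup s i) i) (sym (lookup-corner s x x′ i))

corner-replicate : ∀ {m} b (x x′ : Vec A m) → corner (V.replicate m b) x x′ ≡ (if b then x′ else x)
corner-replicate false []      []       = refl
corner-replicate true  []      []       = refl
corner-replicate false (a ∷ x) (_ ∷ x′) = cong (a ∷_) (corner-replicate false x x′)
corner-replicate true  (_ ∷ x) (b ∷ x′) = cong (b ∷_) (corner-replicate true x x′)

replicate∈allBools : ∀ m b → V.replicate m b ∈ allBools m
replicate∈allBools zero    b     = here refl
replicate∈allBools (suc m) false =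
  ∈-concatMap⁺ (λ s → (false ∷ s) ∷ (true ∷ s) ∷ []) (Any.map (λ { refl → here refl }) (replicate∈allBools m false))
replicate∈allBools (suc m) true  =
  ∈-concatMap⁺ (λ s → (false ∷ s) ∷ (true ∷ s) ∷ []) (Any.map (λ { refl → there (here refl) }) (replicate∈allBools m true))

lookup-dupClause-false : ∀ {m} (s : Vec Bool m) (c : Clause m) i →
  lookup (dupClause s c) (dup false i) ≡ (if lookup s i then nothing else lookup c i)
lookup-dupClause-false s c i = trans (VP.lookup-++ˡ (V.zipWith _ s c) (V.zipWith _ s c) i) (VP.lookup-zipWith _ i s c)

lookup-dupClause-true : ∀ {m} (s : Vec Bool m) (c : Clause m) i →
  lookup (dupClause s c) (dup true i) ≡ (if lookup s i then lookup c i else nothing)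
lookup-dupClause-true s c i = trans (VP.lookup-++ʳ (V.zipWith _ s c) (V.zipWith _ s c) i) (VP.lookup-zipWith _ i s c)

lookup-dupClause-chosen : ∀ {m} (s : Vec Bool m) (c : Clause m) i → lookup (dupClause s c) (dup (lookup s i) i) ≡ lookup c i
lookup-dupClause-chosen s c i with lookup s i in si
... | false = trans (lookup-dupClause-false s c i) (cong (λ t → if t then nothing else lookup c i) si)
... | true  = trans (lookup-dupClause-true s c i) (cong (λ t → if t then lookup c i else nothing) si)

lookup-dupClause-just : ∀ {m} (s : Vec Bool m) (c : Clause m) b i {β} →
  lookup (dupClause s c) (dup b i) ≡ just β → lookup s i ≡ b × lookup c i ≡ just β
lookup-dupClause-just s c false i e with lookup s i | lookup-dupClause-false s c i
... | false | eq = refl , trans (sym eq) e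
... | true  | eq with () ← trans (sym eq) e
lookup-dupClause-just s c true  i e with lookup s i | lookup-dupClause-true s c i
... | true  | eq = refl , trans (sym eq) e
... | false | eq with () ← trans (sym eq) e

∈-blowup2⁺ : ∀ {m} {F : Formula m} {s c} → s ∈ allBools m → c ∈ F → dupClause s c ∈ blowup2 F
∈-blowup2⁺ {m} s∈ c∈F =
  ∈-concatMap⁺ (λ c → map (λ s → dupClause s c) (allBools m)) (Any.map (λ { refl → ∈-map⁺ (λ s → dupClause s _) s∈ }) c∈F)

∈-blowup2⁻ : ∀ {m} {F : Formula m} {d} → d ∈ blowup2 F →
  Σ (Vec Bool m) λ s → Σ (Clause m) λ c → s ∈ allBools m × c ∈ F × d ≡ dupClause s c
∈-blowup2⁻ {m} {F} d∈ with find (∈-concatMap⁻ (λ c → map (λ s → dupClause s c) (allBools m)) {xs = F} d∈)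
... | c , c∈F , d∈c[2] with ∈-map⁻ (λ s → dupClause s c) d∈c[2]
...   | s , s∈ , refl = s , c , s∈ , c∈F , refl

appears-blowup2 : ∀ {m} (F : Formula m) b i → T (appears (blowup2 F) (dup b i)) → T (appears F i)
appears-blowup2 F b i app with appears⁻ (blowup2 F) app
... | d , d∈ , occ with ∈-blowup2⁻ {F = F} d∈
...   | s , c , _ , c∈F , refl with Occurs⇒just {c = dupClause s c} occ
...     | β , e = appears⁺ F c∈F (just⇒Occurs {c = c} (proj₂ (lookup-dupClause-just s c b i e)))

-- Copies of F[2] from boxes of embeddings

module BoxCopies {m n : ℕ} (F : Formula m) (G : Formula n) where

  open Embeddings F G
  open import Data.List.Membership.DecPropositional (_≟ᶜ_ {n}) using (_∈?_)

  -- The box (x, x′) read as a map of the variables of F[2]: i ↦ x i, i′ ↦ x′ i.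
  ⟨_,_⟩ : Vec (Fin n) m → Vec (Fin n) m → Fin (m + m) → Fin n
  ⟨ x , x′ ⟩ = lookup (x V.++ x′)

  Box : Vec (Fin n) m → Vec (Fin n) m → Set
  Box x x′ = T (boxIn embeds x x′)

  Separated : Vec (Fin n) m → Vec (Fin n) m → Set
  Separated x x′ = ∀ i j → lookup x i ≢ lookup x′ j

  GoodBox : Vec (Fin n) m → Vec (Fin n) m → Set
  GoodBox x x′ = Box x x′ × Separated x x′

  goodBox? : ∀ x x′ → Dec (GoodBox x x′)
  goodBox? x x′ = T? (boxIn embeds x x′) ×-dec FinP.all? λ i → FinP.all? λ j → ¬? (lookup x i Fin.≟ lookup x′ j)

  image : Vec (Fin n) m → Vec (Fin n) m → Formula n
  image x x′ = map (rename ⟨ x , x′ ⟩) (blowup2 F)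

  boxCopy : Vec (Fin n) m → Vec (Fin n) m → Subformula G
  boxCopy x x′ = selectionOf G (λ d → does (d ∈? image x x′))

  corner-embeds : ∀ {x x′} → Box x x′ → ∀ {s} → s ∈ allBools m → Embeds (corner s x x′)
  corner-embeds {x} {x′} box {s} s∈ =
    does⇒ (embeds? (corner s x x′)) (all-∈ (λ s → embeds (corner s x x′)) (allBools m) box s∈)

  side-embeds : ∀ {x x′} → Box x x′ → ∀ b → Embeds (if b then x′ else x)
  side-embeds {x} {x′} box b = subst Embeds (corner-replicate b x x′) (corner-embeds box (replicate∈allBools m b))

  rename-dupClause : ∀ x x′ s c → InjectiveOnVars F (lookup (corner s x x′)) → c ∈ F →
    rename ⟨ x , x′ ⟩ (dupClause s c) ≡ rename (lookup (corner s x x′)) c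
  rename-dupClause x x′ s c ψ-inj c∈F = vec-ext λ y → maybe-ext (from-dup y) (to-dup y)
    where
    ψ : Fin m → Fin n
    ψ = lookup (corner s x x′)
    from-dup : ∀ y β → lookup (rename ⟨ x , x′ ⟩ (dupClause s c)) y ≡ just β → lookup (rename ψ c) y ≡ just β
    from-dup y β e with rename-just⇒ ⟨ x , x′ ⟩ (dupClause s c) e
    ... | z , refl , dz with dupView m z
    ...   | dup-of b i with lookup-dupClause-just s c b i dz
    ...     | si≡b , ci = subst (λ y → lookup (rename ψ c) y ≡ just β) (sym (lookup-++-corner s x x′ i si≡b))
                                (rename-just-injective F ψ-inj c∈F ci)
    to-dup : ∀ y β → lookup (rename ψ c) y ≡ just β → lookup (rename ⟨ x , x′ ⟩ (dupClause s c)) y ≡ just β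
    to-dup y β e with rename-just⇒ ψ c e
    ... | i , refl , ci = subst (λ y → lookup (rename ⟨ x , x′ ⟩ (dupClause s c)) y ≡ just β)
                                (lookup-++-corner s x x′ i refl)
                                (rename-just⇐ ⟨ x , x′ ⟩ (dupClause s c) unique (trans (lookup-dupClause-chosen s c i) ci))
      where
      unique : ∀ z β′ → ⟨ x , x′ ⟩ z ≡ ⟨ x , x′ ⟩ (dup (lookup s i) i) →
        lookup (dupClause s c) z ≡ just β′ → β′ ≡ β
      unique z β′ Φz≡Φi dz with dupView m z
      ... | dup-of b i′ with lookup-dupClause-just s c b i′ dz
      ...   | si′≡b , ci′ = same-image⇒same-sign F ψ-inj c∈F
                              (trans (sym (lookup-++-corner s x x′ i′ si′≡b)) (trans Φz≡Φi (lookup-++-corner s x x′ i refl)))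
                              ci′ ci

  image⊆G : ∀ {x x′} → Box x x′ → ∀ {d} → d ∈ image x x′ → d ∈ G
  image⊆G {x} {x′} box d∈ with ∈-map⁻ (rename ⟨ x , x′ ⟩) d∈
  ... | e , e∈ , refl with ∈-blowup2⁻ {F = F} e∈
  ...   | s , c , s∈ , c∈F , refl with corner-embeds box s∈
  ...     | ψ-inj , ψF⊆G = subst (_∈ G) (sym (rename-dupClause x x′ s c ψ-inj c∈F)) (All.lookup ψF⊆G c∈F)

  ⟨⟩-injective : ∀ {x x′} → GoodBox x x′ → InjectiveOnVars (blowup2 F) ⟨ x , x′ ⟩
  ⟨⟩-injective {x} {x′} (box , separated) z z′ z∈ z′∈ Φz≡Φz′ with dupView m z | dupView m z′
  ... | dup-of b i | dup-of b′ j =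
    same-side b b′ (trans (sym (lookup-++-dup x x′ b i)) (trans Φz≡Φz′ (lookup-++-dup x x′ b′ j)))
    where
    i∈F : T (appears F i)
    i∈F = appears-blowup2 F b i z∈
    j∈F : T (appears F j)
    j∈F = appears-blowup2 F b′ j z′∈
    same-side : ∀ b b′ → (if b then lookup x′ i else lookup x i) ≡ (if b′ then lookup x′ j else lookup x j) → dup b i ≡ dup b′ j
    same-side false false e = cong (dup false) (proj₁ (side-embeds box false) i j i∈F j∈F e)
    same-side true  true  e = cong (dup true)  (proj₁ (side-embeds box true) i j i∈F j∈F e)
    same-side false true  e = ⊥-elim (separated i j e)
    same-side true  false e = ⊥-elim (separated j i (sym e))

  image≈boxCopy : ∀ {x x′} → Box x x′ → image x x′ ≈F select G (boxCopy x x′)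
  image≈boxCopy {x} {x′} box d = mk⇔
    (λ d∈ → ∈-selectionOf⁺ G _ (image⊆G box d∈) (does⇐ (d ∈? image x x′) d∈))
    (λ d∈ → does⇒ (d ∈? image x x′) (∈-selectionOf⁻ G _ d∈))

  goodBox⇒copy : ∀ {x x′} → GoodBox x x′ → IsCopy (blowup2 F) G (boxCopy x x′)
  goodBox⇒copy {x} {x′} good = ⟨ x , x′ ⟩ , ⟨⟩-injective good , image≈boxCopy (proj₁ good)

  side-appears : ∀ {x x′} → Box x x′ → ∀ b i → T (appears F i) →
    T (appears (select G (boxCopy x x′)) (if b then lookup x′ i else lookup x i))
  side-appears {x} {x′} box b i i∈F with appears⁻ F i∈F
  ... | c , c∈F , i∈c with Occurs⇒just {c = c} i∈c
  ...   | β , ci = appears⁺ (select G (boxCopy x x′)) d∈copy (just⇒Occurs {c = d} d-at-side)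
    where
    s : Vec Bool m
    s = V.replicate m b
    d : Clause n
    d = rename ⟨ x , x′ ⟩ (dupClause s c)
    d∈copy : d ∈ select G (boxCopy x x′)
    d∈copy = Equivalence.to (image≈boxCopy box d) (∈-map⁺ (rename ⟨ x , x′ ⟩) (∈-blowup2⁺ (replicate∈allBools m b) c∈F))
    ψ-inj : InjectiveOnVars F (lookup (corner s x x′))
    ψ-inj = proj₁ (corner-embeds box (replicate∈allBools m b))
    d-at-side : lookup d (if b then lookup x′ i else lookup x i) ≡ just β
    d-at-side = begin
      lookup d (if b then lookup x′ i else lookup x i)            ≡⟨ cong (lookup d) (lookup-++-dup x x′ b i) ⟨
      lookup d (⟨ x , x′ ⟩ (dup b i))                              ≡⟨ cong₂ lookup (rename-dupClause x x′ s c ψ-inj c∈F)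
                                                                                    (lookup-++-corner s x x′ i (VP.lookup-replicate i b)) ⟩
      lookup (rename (lookup (corner s x x′)) c) (lookup (corner s x x′) i) ≡⟨ rename-just-injective F ψ-inj c∈F ci ⟩
      just β                                                       ∎
      where open ≡-Reasoning

  copyVertices⊆image : ∀ {x x′} → Box x x′ → ∀ {w} → T (appears (select G (boxCopy x x′)) w) →
    w ∈ map ⟨ x , x′ ⟩ (L.allFin (m + m))
  copyVertices⊆image {x} {x′} box {w} w∈copy with appears⁻ (select G (boxCopy x x′)) w∈copy
  ... | d , d∈copy , w∈d with ∈-map⁻ (rename ⟨ x , x′ ⟩) (Equivalence.from (image≈boxCopy box d) d∈copy)
  ...   | e , _ , refl with Occurs⇒just {c = rename ⟨ x , x′ ⟩ e} w∈d
  ...     | β , dw with rename-just⇒ ⟨ x , x′ ⟩ e dw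
  ...       | z , refl , _ = ∈-map⁺ ⟨ x , x′ ⟩ (∈-allFin z)

module BoxCount {m n : ℕ} (F : Formula m) (G : Formula n) where

  open Embeddings F G
  open BoxCopies F G

  _≟ˢ_ : (S S′ : Subformula G) → Dec (S ≡ S′)
  _≟ˢ_ = VP.≡-dec _≟ᵇ_

  V : List (Vec (Fin n) m)
  V = allVecs n m

  pairs : List (Vec (Fin n) m × Vec (Fin n) m)
  pairs = cartesianProduct V V

  blowupCopies : List (Subformula G)
  blowupCopies = L.deduplicate _≟ˢ_ (map (uncurry boxCopy) (L.filter (uncurry goodBox?) pairs))

  blowupCopies-unique : Unique blowupCopies
  blowupCopies-unique = UniqueP.deduplicate-! _≟ˢ_ _

  blowupCopies-origin : ∀ {S} → S ∈ blowupCopies →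
    Σ (Vec (Fin n) m × Vec (Fin n) m) λ p → GoodBox (proj₁ p) (proj₂ p) × uncurry boxCopy p ≡ S
  blowupCopies-origin S∈ with ∈-map⁻ (uncurry boxCopy) (∈-deduplicate⁻ _≟ˢ_ _ S∈)
  ... | p , p∈ , refl = p , proj₂ (∈-filter⁻ (uncurry goodBox?) {xs = pairs} p∈) , refl

  blowupCopies-copies : All (IsCopy (blowup2 F) G) blowupCopies
  blowupCopies-copies = All.tabulate λ S∈ →
    let (_ , good , S≡) = blowupCopies-origin S∈ in subst (IsCopy (blowup2 F) G) S≡ (goodBox⇒copy good)

  goodBox⇒∈blowupCopies : ∀ {p} → p ∈ pairs → GoodBox (proj₁ p) (proj₂ p) → uncurry boxCopy p ∈ blowupCopies
  goodBox⇒∈blowupCopies p∈ good = ∈-deduplicate⁺ _≟ˢ_ (∈-map⁺ (uncurry boxCopy) (∈-filter⁺ (uncurry goodBox?) p∈ good))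

  copyVertices≤ : ∀ {x x′} → Box x x′ → ∑ (L.allFin n) (λ w → χ (appears (select G (boxCopy x x′)) w)) ≤ m + m
  copyVertices≤ {x} {x′} box = begin
    ∑ (L.allFin n) (λ w → χ (appears (select G (boxCopy x x′)) w))
      ≤⟨ ∑-mono-≤ (L.allFin n) (λ w → χ-mono _ (copyVertices⊆image box) (Any.any? (w Fin.≟_) vertices)) ⟩
    ∑ (L.allFin n) (λ w → χᵈ (Any.any? (w Fin.≟_) vertices))
      ≤⟨ ∑-allFin-∈ vertices ⟩
    length vertices
      ≡⟨ trans (ListP.length-map ⟨ x , x′ ⟩ (L.allFin (m + m))) (length-allFin (m + m)) ⟩
    m + m ∎
    where
    open ≤-Reasoning
    vertices : List (Fin n)
    vertices = map ⟨ x , x′ ⟩ (L.allFin (m + m))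

  Into : Subformula G → Vec (Fin n) m → Set
  Into S x = ∀ i → T (appears F i) → T (appears (select G S) (lookup x i))

  into? : ∀ S x → Dec (Into S x)
  into? S x = FinP.all? (λ i → T? (appears F i) →-dec T? (appears (select G S) (lookup x i)))

  used : ℕ
  used = countTrue m (appears F)

  -- Each variable of F has at most 2m possible images inside a copy of F[2], the others n.
  maxFibre : ℕ
  maxFibre = (m + m) ^ used * n ^ unused

  #into≤ : ∀ {x₀ x₀′} → Box x₀ x₀′ → ∑ V (λ x → χᵈ (into? (boxCopy x₀ x₀′) x)) ≤ maxFibre
  #into≤ {x₀} {x₀′} box = begin
    ∑ V (λ x → χᵈ (into? S x))                                       ≡⟨ ∑-allVecs-∀ m _ choice? ⟩
    ∏ m (λ i → ∑ (L.allFin n) (λ a → χᵈ (choice? i a)))              ≤⟨ ∏-mono-≤ m choices ⟩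
    ∏ m (λ i → if appears F i then m + m else n)                     ≡⟨ ∏-if m (appears F) (m + m) n ⟩
    (m + m) ^ used * n ^ unused                                      ∎
    where
    open ≤-Reasoning
    S : Subformula G
    S = boxCopy x₀ x₀′
    choice? : ∀ i a → Dec (T (appears F i) → T (appears (select G S) a))
    choice? i a = T? (appears F i) →-dec T? (appears (select G S) a)
    choices : ∀ i → ∑ (L.allFin n) (λ a → χᵈ (choice? i a)) ≤ (if appears F i then m + m else n)
    choices i with appears F i
    ... | true  = ≤-trans (≤-reflexive (∑-allFin-→ true (T? ∘ appears (select G S)))) (copyVertices≤ box)
    ... | false = ≤-reflexive (∑-allFin-→ false (T? ∘ appears (select G S)))

  good-copy⇒into : ∀ S x x′ → χᵈ (goodBox? x x′) * χᵈ (boxCopy x x′ ≟ˢ S) ≤ χᵈ (into? S x) * χᵈ (into? S x′)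
  good-copy⇒into S x x′ = cases (goodBox? x x′) (boxCopy x x′ ≟ˢ S)
    where
    cases : (g : Dec (GoodBox x x′)) (e : Dec (boxCopy x x′ ≡ S)) → χᵈ g * χᵈ e ≤ χᵈ (into? S x) * χᵈ (into? S x′)
    cases (yes (box , _)) (yes refl) = ≤-reflexive (sym (cong₂ _*_ (χᵈ-yes (into? S x) (side-appears box false))
                                                                  (χᵈ-yes (into? S x′) (side-appears box true))))
    cases (yes _)         (no _)     = z≤n
    cases (no _)          _          = z≤n

  #goodBoxes-spanning≤ : ∀ {S} → S ∈ blowupCopies →
    ∑ pairs (λ p → χᵈ (uncurry goodBox? p) * χᵈ (uncurry boxCopy p ≟ˢ S)) ≤ maxFibre * maxFibre
  #goodBoxes-spanning≤ {S} S∈ with blowupCopies-origin S∈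
  ... | (x₀ , x₀′) , (box , _) , refl = begin
    ∑ pairs (λ p → χᵈ (uncurry goodBox? p) * χᵈ (uncurry boxCopy p ≟ˢ S))
      ≤⟨ ∑-mono-≤ pairs (λ p → good-copy⇒into S (proj₁ p) (proj₂ p)) ⟩
    ∑ pairs (λ p → χᵈ (into? S (proj₁ p)) * χᵈ (into? S (proj₂ p)))
      ≡⟨ ∑-cartesianProductWith _,_ V V _ ⟩
    ∑ V (λ x → ∑ V (λ x′ → χᵈ (into? S x) * χᵈ (into? S x′)))
      ≡⟨ ∑-cong V (λ x → ∑-*ˡ V (χᵈ (into? S x)) _) ⟨
    ∑ V (λ x → χᵈ (into? S x) * ∑ V (λ x′ → χᵈ (into? S x′)))
      ≡⟨ ∑-*ʳ V _ _ ⟨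
    ∑ V (λ x → χᵈ (into? S x)) * ∑ V (λ x′ → χᵈ (into? S x′))
      ≤⟨ *-mono-≤ (#into≤ box) (#into≤ box) ⟩
    maxFibre * maxFibre ∎
    where open ≤-Reasoning

  #goodBoxes≤ : ∑ pairs (λ p → χᵈ (uncurry goodBox? p)) ≤ length blowupCopies * (maxFibre * maxFibre)
  #goodBoxes≤ = begin
    ∑ pairs (λ p → χᵈ (uncurry goodBox? p))
      ≤⟨ ∑-mono-≤-∈ pairs spans-some-copy ⟩
    ∑ pairs (λ p → ∑ blowupCopies (λ S → χᵈ (uncurry goodBox? p) * χᵈ (uncurry boxCopy p ≟ˢ S)))
      ≡⟨ ∑-comm pairs blowupCopies _ ⟩
    ∑ blowupCopies (λ S → ∑ pairs (λ p → χᵈ (uncurry goodBox? p) * χᵈ (uncurry boxCopy p ≟ˢ S)))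
      ≤⟨ ∑-mono-≤-∈ blowupCopies #goodBoxes-spanning≤ ⟩
    ∑ blowupCopies (λ _ → maxFibre * maxFibre)
      ≡⟨ ∑-const blowupCopies _ ⟩
    length blowupCopies * (maxFibre * maxFibre) ∎
    where
    open ≤-Reasoning
    spans-some-copy : ∀ {p} → p ∈ pairs →
      χᵈ (uncurry goodBox? p) ≤ ∑ blowupCopies (λ S → χᵈ (uncurry goodBox? p) * χᵈ (uncurry boxCopy p ≟ˢ S))
    spans-some-copy {p} p∈ = spans (uncurry goodBox? p)
      where
      spans : (g : Dec (GoodBox (proj₁ p) (proj₂ p))) → χᵈ g ≤ ∑ blowupCopies (λ S → χᵈ g * χᵈ (uncurry boxCopy p ≟ˢ S))
      spans (no _)     = z≤n
      spans (yes good) = ∑-positive blowupCopies _ (goodBox⇒∈blowupCopies p∈ good)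
                           (≤-reflexive (sym (trans (+-identityʳ _) (χᵈ-yes (uncurry boxCopy p ≟ˢ uncurry boxCopy p) refl))))

  overlaps : Vec (Fin n) m → Vec (Fin n) m → ℕ
  overlaps x x′ = ∑ (L.allFin m) (λ i → ∑ (L.allFin m) (λ j → χᵈ (lookup x i Fin.≟ lookup x′ j)))

  box≤good+overlaps : ∀ x x′ → χ (boxIn embeds x x′) ≤ χᵈ (goodBox? x x′) + overlaps x x′
  box≤good+overlaps x x′ with overlaps x x′ in no-overlap
  ... | suc _ = ≤-trans (χ≤1 (boxIn embeds x x′)) (≤-trans (s≤s z≤n) (m≤n+m _ _))
  ... | zero  = ≤-trans (≤-reflexive (χᵈ-cong (λ box → box , separated) proj₁ (T? (boxIn embeds x x′)) (goodBox? x x′)))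
                        (≤-reflexive (sym (+-identityʳ _)))
    where
    separated : Separated x x′
    separated i j e with () ← trans (sym (χᵈ-yes (lookup x i Fin.≟ lookup x′ j) e))
                                    (∑-zero⁻ (L.allFin m) _ (∑-zero⁻ (L.allFin m) _ no-overlap (∈-allFin i)) (∈-allFin j))

  n*#overlaps : n * ∑ pairs (uncurry overlaps) ≡ m * m * n ^ (m + m)
  n*#overlaps = begin
    n * ∑ pairs (uncurry overlaps)                                          ≡⟨ cong (n *_) (∑-cartesianProductWith _,_ V V _) ⟩
    n * ∑ V (λ x → ∑ V (λ x′ → overlaps x x′))                              ≡⟨ ∑-*ˡ V n _ ⟩
    ∑ V (λ x → n * ∑ V (λ x′ → overlaps x x′))
      ≡⟨ ∑-cong V (λ x → cong (n *_) (trans (∑-comm V Fm _) (∑-cong Fm (λ i → ∑-comm V Fm _)))) ⟩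
    ∑ V (λ x → n * ∑ Fm (λ i → ∑ Fm (λ j → ∑ V (λ x′ → hit x i x′ j))))
      ≡⟨ ∑-cong V (λ x → trans (∑-*ˡ Fm n _) (∑-cong Fm (λ i → ∑-*ˡ Fm n _))) ⟩
    ∑ V (λ x → ∑ Fm (λ i → ∑ Fm (λ j → n * ∑ V (λ x′ → hit x i x′ j))))
      ≡⟨ ∑-cong V (λ x → ∑-cong Fm (λ i → ∑-cong Fm (λ j → n*#hits x i j))) ⟩
    ∑ V (λ x → ∑ Fm (λ i → ∑ Fm (λ j → n ^ m)))
      ≡⟨ ∑-cong V (λ x → trans (∑-cong Fm (λ i → ∑-const Fm _)) (∑-const Fm _)) ⟩
    ∑ V (λ x → length Fm * (length Fm * n ^ m))                             ≡⟨ ∑-const V _ ⟩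
    length V * (length Fm * (length Fm * n ^ m))
      ≡⟨ cong₂ (λ a b → a * (b * (b * n ^ m))) (length-allVecs n m) (length-allFin m) ⟩
    n ^ m * (m * (m * n ^ m))                                               ≡⟨ rearrange (n ^ m) m ⟩
    m * m * (n ^ m * n ^ m)                                                 ≡⟨ cong (m * m *_) (^-distribˡ-+-* n m m) ⟨
    m * m * n ^ (m + m)                                                     ∎
    where
    open ≡-Reasoning
    Fm : List (Fin m)
    Fm = L.allFin m
    hit : Vec (Fin n) m → Fin m → Vec (Fin n) m → Fin m → ℕ
    hit x i x′ j = χᵈ (lookup x i Fin.≟ lookup x′ j)
    n*#hits : ∀ x i j → n * ∑ V (λ x′ → hit x i x′ j) ≡ n ^ m
    n*#hits x i j = trans (cong (n *_) (∑-cong V (λ x′ → χᵈ-cong sym sym (lookup x i Fin.≟ lookup x′ j) (lookup x′ j Fin.≟ lookup x i))))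
                          (∑-allVecs-lookup n m j (lookup x i))
    rearrange : ∀ a m → a * (m * (m * a)) ≡ m * m * (a * a)
    rearrange = solve-∀

  boxes≤good+overlaps : boxes embeds ≤ ∑ pairs (λ p → χᵈ (uncurry goodBox? p)) + ∑ pairs (uncurry overlaps)
  boxes≤good+overlaps = begin
    boxes embeds                                                         ≡⟨ ∑-cartesianProductWith _,_ V V _ ⟨
    ∑ pairs (λ p → χ (boxIn embeds (proj₁ p) (proj₂ p)))
      ≤⟨ ∑-mono-≤ pairs (λ p → box≤good+overlaps (proj₁ p) (proj₂ p)) ⟩
    ∑ pairs (λ p → χᵈ (uncurry goodBox? p) + uncurry overlaps p)         ≡⟨ ∑-distrib-+ pairs _ _ ⟩
    ∑ pairs (λ p → χᵈ (uncurry goodBox? p)) + ∑ pairs (uncurry overlaps) ∎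
    where open ≤-Reasoning

ℕtoℚ≡mkℚ : ∀ a → ℕtoℚ a ≡ mkℚ (ℤ.+ a) 0 (Coprime.sym (1-coprimeTo a))
ℕtoℚ≡mkℚ a = ℚP.normalize-coprime (Coprime.sym (1-coprimeTo a))

-- A positive ε = (1+p)/(1+d) satisfies 1/ε ≤ 1+d.
ε*≤⇒≤* : (ε : ℚ) → 0ℚ < ε → Σ ℕ λ Q → ∀ a b → ε *ℚ ℕtoℚ a ℚ.≤ ℕtoℚ b → a ≤ Q * b
ε*≤⇒≤* (mkℚ ℤ.+[1+ p ] d c) _ = suc d , bound
  where
  bound : ∀ a b → mkℚ ℤ.+[1+ p ] d c *ℚ ℕtoℚ a ℚ.≤ ℕtoℚ b → a ≤ suc d * b
  bound a b h rewrite ℕtoℚ≡mkℚ a | ℕtoℚ≡mkℚ b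
    with ℚᵘP.≤-respˡ-≃ (ℚP.toℚᵘ-homo-* (mkℚ ℤ.+[1+ p ] d c) (mkℚ (ℤ.+ a) 0 (Coprime.sym (1-coprimeTo a))))
                       (ℚP.toℚᵘ-mono-≤ h)
  ... | ℚᵘ.*≤* q = ≤-trans (m≤m+n a (p * a)) (subst (a + p * a ≤_) b*[1+d]≡[1+d]*b (ℤP.drop‿+≤+ [1+p]a≤b[1+d]))
    where
    [1+p]a≤b[1+d] : ℤ.+ (a + p * a) ℤ.≤ ℤ.+ (b * suc (d * 1))
    [1+p]a≤b[1+d] = subst₂ ℤ._≤_ (trans (ℤP.*-identityʳ _) (ℤP.+◃n≡+n (a + p * a))) (sym (ℤP.pos-* b (suc (d * 1)))) q
    b*[1+d]≡[1+d]*b : b * suc (d * 1) ≡ suc d * b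
    b*[1+d]≡[1+d]*b = trans (cong (λ z → b * suc z) (*-identityʳ d)) (*-comm b (suc d))
ε*≤⇒≤* (mkℚ (ℤ.+ zero)  d c) (ℚ.*<* (ℤ.+<+ ()))
ε*≤⇒≤* (mkℚ ℤ.-[1+ p ] d c) (ℚ.*<* ())

1/suc : ℕ → ℚ
1/suc D = mkℚ (ℤ.+ 1) D (1-coprimeTo (suc D))

1/suc-positive : ∀ D → 0ℚ < 1/suc D
1/suc-positive D = ℚ.*<* (ℤ.+<+ (s≤s z≤n))

≤suc*⇒1/suc*≤ : ∀ D a b → a ≤ suc D * b → 1/suc D *ℚ ℕtoℚ a ℚ.≤ ℕtoℚ b
≤suc*⇒1/suc*≤ D a b h rewrite ℕtoℚ≡mkℚ a | ℕtoℚ≡mkℚ b =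
  ℚP.toℚᵘ-cancel-≤ (ℚᵘP.≤-respˡ-≃ (ℚᵘP.≃-sym (ℚP.toℚᵘ-homo-* (1/suc D) (mkℚ (ℤ.+ a) 0 (Coprime.sym (1-coprimeTo a)))))
                                 (ℚᵘ.*≤* cross-multiplied))
  where
  a+0≤b*[1+D] : a + 0 ≤ b * suc (D * 1)
  a+0≤b*[1+D] = subst₂ _≤_ (sym (+-identityʳ a))
    (trans (*-comm (suc D) b) (cong (λ z → b * suc z) (sym (*-identityʳ D)))) h
  cross-multiplied : ℤ.+ 1 ℤ.* ℤ.+ a ℤ.* ℤ.+ 1 ℤ.≤ ℤ.+ b ℤ.* ℤ.+ suc (D * 1)
  cross-multiplied = subst₂ ℤ._≤_ (trans (sym (ℤP.+◃n≡+n (a + 0))) (sym (ℤP.*-identityʳ _)))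
    (ℤP.pos-* b (suc (D * 1))) (ℤ.+≤+ a+0≤b*[1+D])

-- When n · Deg = M · X with 2RM < n, the term R · Deg is at most X / 2 and can be absorbed.
absorb : ∀ {X R Good Deg M n} → X ≤ R * (Good + Deg) → n * Deg ≡ M * X → n > 2 * R * M → X ≤ 2 * R * Good
absorb {X} {R} {Good} {Deg} {M} {n@(suc _)} X≤ nDeg≡MX 2RM<n = +-cancelʳ-≤ X X (2 * R * Good) (begin
  X + X                          ≡⟨ cong (X +_) (+-identityʳ X) ⟨
  2 * X                          ≤⟨ *-monoʳ-≤ 2 X≤ ⟩
  2 * (R * (Good + Deg))         ≡⟨ distribute R Good Deg ⟩
  2 * R * Good + 2 * (R * Deg)   ≤⟨ +-monoʳ-≤ (2 * R * Good) 2RDeg≤X ⟩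
  2 * R * Good + X               ∎)
  where
  open ≤-Reasoning
  distribute : ∀ R G D → 2 * (R * (G + D)) ≡ 2 * R * G + 2 * (R * D)
  distribute = solve-∀
  reassociate : ∀ n R D → n * (2 * (R * D)) ≡ 2 * R * (n * D)
  reassociate = solve-∀
  2RDeg≤X : 2 * (R * Deg) ≤ X
  2RDeg≤X = *-cancelˡ-≤ n (begin
    n * (2 * (R * Deg))   ≡⟨ reassociate n R Deg ⟩
    2 * R * (n * Deg)     ≡⟨ cong (2 * R *_) nDeg≡MX ⟩
    2 * R * (M * X)       ≡⟨ *-assoc (2 * R) M X ⟨
    2 * R * M * X         ≤⟨ *-monoˡ-≤ X (<⇒≤ 2RM<n) ⟩
    n * X                 ∎)

v≡countTrue : ∀ {m} (F : Formula m) → v F ≡ countTrue m (appears F)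
v≡countTrue {m} F = length-filterᵇ (appears F) (L.allFin m)

module Supersaturation {m n : ℕ} (F : Formula m) (G : Formula n) (G! : Unique G) where

  open Embeddings F G
  open BoxCopies F G
  open BoxCount F G

  n^m≤Q*embeddings : ∀ {Q Ss} → Unique Ss → All (IsCopy F G) Ss → n ^ used ≤ Q * length Ss → n ^ m ≤ Q * count embeds
  n^m≤Q*embeddings {Q} {Ss} Ss! copies enough = begin
    n ^ m                            ≡⟨ cong (n ^_) (countTrue+countFalse m (appears F)) ⟨
    n ^ (used + unused)              ≡⟨ ^-distribˡ-+-* n used unused ⟩
    n ^ used * n ^ unused            ≤⟨ *-monoˡ-≤ (n ^ unused) enough ⟩
    Q * length Ss * n ^ unused       ≡⟨ *-assoc Q _ _ ⟩
    Q * (length Ss * n ^ unused)     ≤⟨ *-monoʳ-≤ Q (copies*n^unused≤embeddings G! Ss! copies) ⟩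
    Q * count embeds                 ∎
    where open ≤-Reasoning

  n^2m≤R*boxes : ∀ {Q} → n ^ m ≤ Q * count embeds → .{{NonZero n}} → n ^ (m + m) ≤ Q ^ (2 ^ m) * boxes embeds
  n^2m≤R*boxes {Q} n^m≤ = *-cancelʳ-≤ _ _ (n ^ (m * 2 ^ m)) {{m^n≢0 n (m * 2 ^ m)}} (begin
    n ^ (m + m) * n ^ (m * 2 ^ m)                 ≡⟨ *-comm (n ^ (m + m)) _ ⟩
    n ^ (m * 2 ^ m) * n ^ (m + m)                 ≡⟨ cong (_* n ^ (m + m)) (^-*-assoc n m (2 ^ m)) ⟨
    (n ^ m) ^ (2 ^ m) * n ^ (m + m)               ≤⟨ *-monoˡ-≤ (n ^ (m + m)) (^-monoˡ-≤ (2 ^ m) n^m≤) ⟩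
    (Q * count embeds) ^ (2 ^ m) * n ^ (m + m)    ≡⟨ cong (_* n ^ (m + m)) (^-distrib-* Q (count embeds) (2 ^ m)) ⟩
    Q ^ (2 ^ m) * count embeds ^ (2 ^ m) * n ^ (m + m)
                                                  ≡⟨ *-assoc (Q ^ (2 ^ m)) _ _ ⟩
    Q ^ (2 ^ m) * (count embeds ^ (2 ^ m) * n ^ (m + m))
                                                  ≤⟨ *-monoʳ-≤ (Q ^ (2 ^ m)) (box-count m embeds) ⟩
    Q ^ (2 ^ m) * (boxes embeds * n ^ (m * 2 ^ m)) ≡⟨ *-assoc (Q ^ (2 ^ m)) _ _ ⟨
    Q ^ (2 ^ m) * boxes embeds * n ^ (m * 2 ^ m)   ∎)
    where open ≤-Reasoning

  blowup-copies-bound : ∀ {Q Ss} → Unique Ss → All (IsCopy F G) Ss → n ^ v F ≤ Q * length Ss →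
    n > 2 * Q ^ (2 ^ m) * (m * m) →
    n ^ (2 * v F) ≤ suc (2 * Q ^ (2 ^ m) * ((m + m) ^ v F * (m + m) ^ v F)) * length blowupCopies
  blowup-copies-bound {Q} {Ss} Ss! copies enough n-large@(s≤s _) rewrite v≡countTrue F =
    ≤-trans (*-cancelʳ-≤ _ _ (N * N) {{N*N≢0}} (begin
      n ^ (2 * used) * (N * N)                          ≡⟨ split-vertices ⟨
      n ^ (m + m)
        ≤⟨ absorb {R = R} {Good} {M = m * m} n^2m≤R*[good+overlaps] n*#overlaps n-large ⟩
      2 * R * Good                                      ≤⟨ *-monoʳ-≤ (2 * R) #goodBoxes≤ ⟩
      2 * R * (length blowupCopies * (K * N * (K * N))) ≡⟨ rearrange (2 * R) (length blowupCopies) K N ⟩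
      2 * R * (K * K) * length blowupCopies * (N * N)   ∎))
      (m≤n+m _ (length blowupCopies))
    where
    open ≤-Reasoning
    R K N Good : ℕ
    R = Q ^ (2 ^ m)
    K = (m + m) ^ used
    N = n ^ unused
    Good = ∑ pairs (λ p → χᵈ (uncurry goodBox? p))
    N*N≢0 : NonZero (N * N)
    N*N≢0 = m*n≢0 N N {{m^n≢0 n unused}} {{m^n≢0 n unused}}
    n^2m≤R*[good+overlaps] : n ^ (m + m) ≤ R * (Good + ∑ pairs (uncurry overlaps))
    n^2m≤R*[good+overlaps] =
      ≤-trans (n^2m≤R*boxes (n^m≤Q*embeddings {Q} Ss! copies enough)) (*-monoʳ-≤ R boxes≤good+overlaps)
    rearrange : ∀ r d k N → r * (d * (k * N * (k * N))) ≡ r * (k * k) * d * (N * N)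
    rearrange = solve-∀
    split-vertices : n ^ (m + m) ≡ n ^ (2 * used) * (N * N)
    split-vertices = begin-equality
      n ^ (m + m)                                 ≡⟨ cong (λ z → n ^ (z + z)) (countTrue+countFalse m (appears F)) ⟨
      n ^ (used + unused + (used + unused))       ≡⟨ cong (n ^_) (regroup used unused) ⟩
      n ^ (2 * used + (unused + unused))          ≡⟨ ^-distribˡ-+-* n (2 * used) (unused + unused) ⟩
      n ^ (2 * used) * n ^ (unused + unused)      ≡⟨ cong (n ^ (2 * used) *_) (^-distribˡ-+-* n unused unused) ⟩
      n ^ (2 * used) * (N * N)                    ∎
      where
      regroup : ∀ a b → a + b + (a + b) ≡ 2 * a + (b + b)
      regroup = solve-∀

lemma3p1 : (k : ℕ) (ε : ℚ) → 0ℚ < ε → (m : ℕ) (F : KSAT k m) →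
    Σ ℚ λ δ → 0ℚ < δ × Σ ℕ λ n₀ → (n : ℕ) → n > n₀ → (G : KSAT k n) →
      AtLeastCopies (ε *ℚ ℕtoℚ (n ^ v (clauses F))) (clauses F) (clauses G) →
      AtLeastCopies (δ *ℚ ℕtoℚ (n ^ (2 * v (clauses F)))) (blowup2 (clauses F)) (clauses G)
lemma3p1 k ε ε>0 m F = 1/suc Δ , 1/suc-positive Δ , n₀ , supersaturated
  where
  Q R K Δ n₀ : ℕ
  Q  = proj₁ (ε*≤⇒≤* ε ε>0)
  R  = Q ^ (2 ^ m)
  K  = (m + m) ^ v (clauses F)
  Δ  = 2 * R * (K * K)
  n₀ = 2 * R * (m * m)
  supersaturated : (n : ℕ) → n > n₀ → (G : KSAT k n) →
    AtLeastCopies (ε *ℚ ℕtoℚ (n ^ v (clauses F))) (clauses F) (clauses G) →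
    AtLeastCopies (1/suc Δ *ℚ ℕtoℚ (n ^ (2 * v (clauses F)))) (blowup2 (clauses F)) (clauses G)
  supersaturated n n>n₀ G (Ss , Ss! , copies , enough) =
    blowupCopies , blowupCopies-unique , blowupCopies-copies ,
    ≤suc*⇒1/suc*≤ Δ _ _ (blowup-copies-bound Ss! copies (proj₂ (ε*≤⇒≤* ε ε>0) _ _ enough) n>n₀)
    where
    open BoxCount (clauses F) (clauses G)
    open Supersaturation (clauses F) (clauses G) (distinct G)
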